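{- For $n\ge2$ let $R_n$ be the linear hexagonal cylinder chain with vertices $p_i,q_i,u_i,v_i$, $i\in\{1,\dots,n\}$ (indices modulo $n$) and edges $p_iq_i$, $p_iu_i$, $u_ip_{i+1}$, $q_iv_i$, $v_iq_{i+1}$ ($1\le i\le n$), and let $\alpha=3-2\sqrt2$. Then $$K\!f(R_n)=\frac{4n^3-n}{3}+3\sqrt2\,n^2\,\frac{1+\alpha^n}{1-\alpha^n}.$$
   Context: The Kirchhoff index of a connected graph $G$ is $K\!f(G)=\sum_{\{u,v\}\subseteq V(G)}r_G(u,v)$, summed over unordered pairs of distinct vertices, where $r_G(u,v)$ is the effective resistance between $u$ and $v$ when each edge is a unit resistor. $R_n$ is the graph obtained from a row of $n$ hexagons by identifying the two opposite lateral edges. -}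

module Defs where

open import Data.Nat as ℕ using (ℕ; zero; suc)
open import Data.Nat.DivMod using (_%_; m%n<n)
open import Data.Fin as Fin using (Fin; toℕ; fromℕ<)
import Data.Fin.Properties as FinP
import Data.Integer
open import Data.Rational as ℚ using (ℚ; 0ℚ; 1ℚ; _+_; _*_; _-_; -_; 1/_; ≢-nonZero)
open import Data.Rational.Properties using () renaming (_≟_ to _≟ℚ_)
open import Data.List using (List; []; _∷_; _++_; map; concatMap; sum)
open import Data.List.Base using (foldr)
open import Data.Product using (_×_; _,_; Σ; proj₁; proj₂)
open import Relation.Binary.PropositionalEquality using (_≡_)
open import Relation.Nullary using (yes; no; Dec)

Σℚ : {A : Set} → List A → (A → ℚ) → ℚ
Σℚ xs f = foldr (λ a s → f a + s) 0ℚ xs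

pairs : {A : Set} → List A → List (A × A)
pairs []       = []
pairs (x ∷ xs) = map (x ,_) xs ++ pairs xs

module Graph {V : Set} (_≟_ : (a b : V) → Dec (a ≡ b))
             (vertices : List V) (edges : List (V × V)) where

  δ : V → V → ℚ
  δ a b with a ≟ b
  ... | yes _ = 1ℚ
  ... | no  _ = 0ℚ

  -- Laplacian applied to a potential x:  (L x)_w = Σ_{edges wz} (x_w − x_z)
  edgeTerm : (V → ℚ) → V → V × V → ℚ
  edgeTerm x w (a , b) = δ w a * (x a - x b) + δ w b * (x b - x a)

  Lap : (V → ℚ) → V → ℚ
  Lap x w = Σℚ edges (edgeTerm x w)

  -- r is the effective resistance between u and v (unit resistors):
  -- there is a potential x with L x = e_u − e_v (unit current in at u,
  -- out at v), and r = x_u − x_v.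
  IsEffRes : V → V → ℚ → Set
  IsEffRes u v r = Σ (V → ℚ) λ x →
    ((w : V) → Lap x w ≡ δ u w - δ v w) × (r ≡ x u - x v)

  IsResistanceFn : (V → V → ℚ) → Set
  IsResistanceFn r = (u v : V) → IsEffRes u v (r u v)

  Kf : (V → V → ℚ) → ℚ
  Kf r = Σℚ (pairs vertices) (λ p → r (proj₁ p) (proj₂ p))

data Kind : Set where
  P Q U W : Kind     -- W stands for the paper's v-vertices

_≟K_ : (a b : Kind) → Dec (a ≡ b)
P ≟K P = yes _≡_.refl
Q ≟K Q = yes _≡_.refl
U ≟K U = yes _≡_.refl
W ≟K W = yes _≡_.refl
P ≟K Q = no λ ()
P ≟K U = no λ ()
P ≟K W = no λ ()
Q ≟K P = no λ ()
Q ≟K U = no λ ()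
Q ≟K W = no λ ()
U ≟K P = no λ ()
U ≟K Q = no λ ()
U ≟K W = no λ ()
W ≟K P = no λ ()
W ≟K Q = no λ ()
W ≟K U = no λ ()

-- vertex (k , i) stands for k_i, indices i ∈ Fin n (0-based)
Vtx : ℕ → Set
Vtx n = Kind × Fin n

_≟V_ : ∀ {n} → (a b : Vtx n) → Dec (a ≡ b)
(k , i) ≟V (l , j) with k ≟K l | i FinP.≟ j
... | yes _≡_.refl | yes _≡_.refl = yes _≡_.refl
... | no k≢l | _ = no λ { _≡_.refl → k≢l _≡_.refl }
... | yes _ | no i≢j = no λ { _≡_.refl → i≢j _≡_.refl }

next : ∀ {n} → Fin n → Fin n
next {suc m} i = fromℕ< (m%n<n (suc (toℕ i)) (suc m))

RVertices : (n : ℕ) → List (Vtx n)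
RVertices n = concatMap (λ k → map (k ,_) (Data.List.allFin n)) (P ∷ Q ∷ U ∷ W ∷ [])
  where import Data.List

REdges : (n : ℕ) → List (Vtx n × Vtx n)
REdges n = concatMap (λ i →
     ((P , i) , (Q , i))
   ∷ ((P , i) , (U , i))
   ∷ ((U , i) , (P , next i))
   ∷ ((Q , i) , (W , i))
   ∷ ((W , i) , (Q , next i)) ∷ [])
  (Data.List.allFin n)
  where import Data.List

module R (n : ℕ) = Graph (_≟V_ {n}) (RVertices n) (REdges n)

ℕtoℚ : ℕ → ℚ
ℕtoℚ k = Data.Integer.+ k ℚ./ 1

-- The field ℚ(√2): a + b√2 represented by (a , b)

ℚ√2 : Set
ℚ√2 = ℚ × ℚ

emb : ℚ → ℚ√2
emb a = (a , 0ℚ)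

√2 : ℚ√2
√2 = (0ℚ , 1ℚ)

_⊕_ : ℚ√2 → ℚ√2 → ℚ√2
(a , b) ⊕ (c , d) = (a + c , b + d)

_⊖_ : ℚ√2 → ℚ√2 → ℚ√2
(a , b) ⊖ (c , d) = (a - c , b - d)

_⊗_ : ℚ√2 → ℚ√2 → ℚ√2
(a , b) ⊗ (c , d) = (a * c + ℕtoℚ 2 * (b * d) , a * d + b * c)

-- multiplicative inverse (with the convention 0⁻¹ = 0)
inv : ℚ√2 → ℚ√2
inv (a , b) with (a * a - ℕtoℚ 2 * (b * b)) ≟ℚ 0ℚ
... | yes _ = (0ℚ , 0ℚ)
... | no ne = (a * d , - (b * d))
  where d = 1/_ (a * a - ℕtoℚ 2 * (b * b)) {{≢-nonZero ne}}

_⊘_ : ℚ√2 → ℚ√2 → ℚ√2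
x ⊘ y = x ⊗ inv y

_^√_ : ℚ√2 → ℕ → ℚ√2
x ^√ zero  = emb 1ℚ
x ^√ suc k = x ⊗ (x ^√ k)

α : ℚ√2
α = (ℕtoℚ 3 , - ℕtoℚ 2)

KfFormula : ℕ → ℚ√2
KfFormula n =
  emb ((ℕtoℚ 4 * (N * N * N) - N) * (1/ ℕtoℚ 3))
  ⊕ (((emb (ℕtoℚ 3) ⊗ √2) ⊗ emb (N * N))
     ⊗ ((emb 1ℚ ⊕ (α ^√ n)) ⊘ (emb 1ℚ ⊖ (α ^√ n))))
  where N = ℕtoℚ n

-- For each vertex s we give an explicit potential g s whose Laplacian is δₛ − 1/|V|. Its part
-- symmetric under exchanging the two rows of hexagons is the Green function A(t² − 2nt) of the
-- 2n-cycle P₀ U₀ P₁ U₁ … (t the position along it); in its antisymmetric part the rungs Pᵢ Qᵢ act as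
-- resistors to ground, which gives B(u_d + u_{n−d}) at distance d, where u_d + v_d √8 = (3 + √8)ᵈ.
-- Differences of these potentials give the effective resistances, and these are unique since, by
-- the energy identity, harmonic functions on the connected graph are constant. All row sums of g
-- agree, so Kf = |V| (tr g − row sum): the row sum yields (4n³ − n)/3 and the trace 24n²B(1 + uₙ) =
-- (3/2) n² (1 + uₙ)/vₙ, which is 3√2 n² (1 + αⁿ)/(1 − αⁿ) because αⁿ = uₙ − vₙ √8 and uₙ² − 8vₙ² = 1.

module Submission where

open import Defs
open import Data.Empty using (⊥-elim)
open import Data.Fin using (Fin; zero; suc; toℕ; fromℕ<)
import Data.Fin.Properties as FinP
open import Data.Integer as ℤ using ()
import Data.Integer.Properties as ℤP
open import Data.List using (List; []; _∷_; _++_; map; concatMap; allFin; tabulate; length)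
import Data.List.Properties as ListP
open import Data.List.Relation.Unary.All as All using (All; []; _∷_)
import Data.List.Relation.Unary.All.Properties as AllP
open import Data.Nat as ℕ using (ℕ; zero; suc; _∸_; _<_; _≤_; s≤s; z≤n)
open import Data.Nat.Coprimality using (1-coprimeTo) renaming (sym to coprime-sym)
open import Data.Nat.DivMod using (_%_; m%n<n; n%n≡0; m<n⇒m%n≡m; %-distribˡ-+; m%n%n≡m%n; [m+n]%n≡m%n)
import Data.Nat.Properties as ℕP
open import Data.Product using (_×_; Σ; _,_; proj₁; proj₂)
open import Data.Rational as ℚ using (ℚ; 0ℚ; 1ℚ; ½; _+_; _*_; _-_; -_; 1/_; mkℚ; NonZero) renaming (_≤_ to _≤ℚ_)
import Data.Rational.Properties as ℚP
open import Data.Rational.Solver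
open import Data.Sum using (_⊎_; inj₁; inj₂)
open import Function using (_∘_; id)
open import Relation.Binary.PropositionalEquality
open import Relation.Nullary using (¬_; Dec; yes; no)

open +-*-Solver

lit : ∀ {m} → ℕ → Polynomial m
lit j = con (ℕtoℚ j)

ℕtoℚ≡mkℚ : ∀ k → ℕtoℚ k ≡ mkℚ (ℤ.+ k) 0 (coprime-sym (1-coprimeTo k))
ℕtoℚ≡mkℚ k = ℚP.normalize-coprime (coprime-sym (1-coprimeTo k))

ℕtoℚ-suc : ∀ k → ℕtoℚ (suc k) ≡ 1ℚ + ℕtoℚ k
ℕtoℚ-suc zero    = refl
ℕtoℚ-suc (suc k) = begin
  ℕtoℚ (suc (suc k))                   ≡⟨ cong (ℕtoℚ ∘ suc) (ℕP.*-identityʳ (suc k)) ⟨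
  ℕtoℚ (suc (suc k ℕ.* 1))             ≡⟨ cong (1ℚ +_) (ℕtoℚ≡mkℚ (suc k)) ⟨
  1ℚ + ℕtoℚ (suc k)                    ∎
  where open ≡-Reasoning

-- Unlike ℕtoℚ, toℚ unfolds on suc, so the ring solver can see through it.
toℚ : ℕ → ℚ
toℚ zero    = 0ℚ
toℚ (suc k) = 1ℚ + toℚ k

ℕtoℚ≡toℚ : ∀ k → ℕtoℚ k ≡ toℚ k
ℕtoℚ≡toℚ zero    = refl
ℕtoℚ≡toℚ (suc k) = trans (ℕtoℚ-suc k) (cong (1ℚ +_) (ℕtoℚ≡toℚ k))

toℚ-+ : ∀ a b → toℚ (a ℕ.+ b) ≡ toℚ a + toℚ b
toℚ-+ zero    b = sym (ℚP.+-identityˡ (toℚ b))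
toℚ-+ (suc a) b = trans (cong (1ℚ +_) (toℚ-+ a b)) (sym (ℚP.+-assoc 1ℚ (toℚ a) (toℚ b)))

toℚ-* : ∀ a b → toℚ (a ℕ.* b) ≡ toℚ a * toℚ b
toℚ-* zero    b = sym (ℚP.*-zeroˡ (toℚ b))
toℚ-* (suc a) b = begin
  toℚ (b ℕ.+ a ℕ.* b)     ≡⟨ toℚ-+ b (a ℕ.* b) ⟩
  toℚ b + toℚ (a ℕ.* b)   ≡⟨ cong (toℚ b +_) (toℚ-* a b) ⟩
  toℚ b + toℚ a * toℚ b   ≡⟨ solve 2 (λ x y → y :+ x :* y := (con 1ℚ :+ x) :* y) refl (toℚ a) (toℚ b) ⟩
  (1ℚ + toℚ a) * toℚ b    ∎
  where open ≡-Reasoning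

ℕtoℚ-injective : ∀ {a b} → ℕtoℚ a ≡ ℕtoℚ b → a ≡ b
ℕtoℚ-injective {a} {b} eq =
  ℤP.+-injective (cong ℚ.numerator (trans (sym (ℕtoℚ≡mkℚ a)) (trans eq (ℕtoℚ≡mkℚ b))))

ℕtoℚ-nonZero : ∀ k .{{_ : ℕ.NonZero k}} → NonZero (ℕtoℚ k)
ℕtoℚ-nonZero k = ℚP.pos⇒nonZero (ℕtoℚ k) {{ℚP.normalize-pos k 1}}

-- Finite sums

Σℚ-++ : {A : Set} (xs ys : List A) (f : A → ℚ) → Σℚ (xs ++ ys) f ≡ Σℚ xs f + Σℚ ys f
Σℚ-++ []       ys f = sym (ℚP.+-identityˡ _)
Σℚ-++ (x ∷ xs) ys f = trans (cong (f x +_) (Σℚ-++ xs ys f)) (sym (ℚP.+-assoc (f x) _ _))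

Σℚ-map : {A B : Set} (g : A → B) (xs : List A) (f : B → ℚ) → Σℚ (map g xs) f ≡ Σℚ xs (f ∘ g)
Σℚ-map g []       f = refl
Σℚ-map g (x ∷ xs) f = cong (f (g x) +_) (Σℚ-map g xs f)

Σℚ-concatMap : {A B : Set} (g : A → List B) (xs : List A) (f : B → ℚ) →
               Σℚ (concatMap g xs) f ≡ Σℚ xs (λ a → Σℚ (g a) f)
Σℚ-concatMap g []       f = refl
Σℚ-concatMap g (x ∷ xs) f =
  trans (Σℚ-++ (g x) (concatMap g xs) f) (cong (Σℚ (g x) f +_) (Σℚ-concatMap g xs f))

Σℚ-cong : {A : Set} (xs : List A) {f g : A → ℚ} → (∀ a → f a ≡ g a) → Σℚ xs f ≡ Σℚ xs g
Σℚ-cong []       f≗g = refl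
Σℚ-cong (x ∷ xs) f≗g = cong₂ _+_ (f≗g x) (Σℚ-cong xs f≗g)

Σℚ-zero : {A : Set} (xs : List A) → Σℚ xs (λ _ → 0ℚ) ≡ 0ℚ
Σℚ-zero []       = refl
Σℚ-zero (x ∷ xs) = cong (0ℚ +_) (Σℚ-zero xs)

Σℚ-+ : {A : Set} (xs : List A) (f g : A → ℚ) → Σℚ xs (λ a → f a + g a) ≡ Σℚ xs f + Σℚ xs g
Σℚ-+ []       f g = refl
Σℚ-+ (x ∷ xs) f g = trans (cong (f x + g x +_) (Σℚ-+ xs f g))
  (solve 4 (λ a b c d → (a :+ b) :+ (c :+ d) := (a :+ c) :+ (b :+ d)) refl (f x) (g x) (Σℚ xs f) (Σℚ xs g))

Σℚ-- : {A : Set} (xs : List A) (f g : A → ℚ) → Σℚ xs (λ a → f a - g a) ≡ Σℚ xs f - Σℚ xs g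
Σℚ-- []       f g = refl
Σℚ-- (x ∷ xs) f g = trans (cong (f x - g x +_) (Σℚ-- xs f g))
  (solve 4 (λ a b c d → (a :- b) :+ (c :- d) := (a :+ c) :- (b :+ d)) refl (f x) (g x) (Σℚ xs f) (Σℚ xs g))

Σℚ-*ˡ : {A : Set} (xs : List A) (c : ℚ) (f : A → ℚ) → Σℚ xs (λ a → c * f a) ≡ c * Σℚ xs f
Σℚ-*ˡ []       c f = sym (ℚP.*-zeroʳ c)
Σℚ-*ˡ (x ∷ xs) c f = trans (cong (c * f x +_) (Σℚ-*ˡ xs c f)) (sym (ℚP.*-distribˡ-+ c (f x) _))

Σℚ-const : {A : Set} (xs : List A) (c : ℚ) → Σℚ xs (λ _ → c) ≡ toℚ (length xs) * c
Σℚ-const []       c = sym (ℚP.*-zeroˡ c)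
Σℚ-const (x ∷ xs) c = trans (cong (c +_) (Σℚ-const xs c))
  (solve 2 (λ c l → c :+ l :* c := (con 1ℚ :+ l) :* c) refl c (toℚ (length xs)))

Σℚ-swap : {A B : Set} (xs : List A) (ys : List B) (f : A → B → ℚ) →
          Σℚ xs (λ a → Σℚ ys (f a)) ≡ Σℚ ys (λ b → Σℚ xs (λ a → f a b))
Σℚ-swap []       ys f = sym (Σℚ-zero ys)
Σℚ-swap (x ∷ xs) ys f = trans (cong (Σℚ ys (f x) +_) (Σℚ-swap xs ys f))
  (sym (Σℚ-+ ys (f x) (λ b → Σℚ xs (λ a → f a b))))

Σℚ-pairs : {A : Set} (xs : List A) (F : A → A → ℚ) →
           Σℚ (pairs xs) (λ p → F (proj₁ p) (proj₂ p) + F (proj₂ p) (proj₁ p))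
           ≡ Σℚ xs (λ x → Σℚ xs (F x)) - Σℚ xs (λ x → F x x)
Σℚ-pairs []       F = refl
Σℚ-pairs (x ∷ xs) F = begin
  Σℚ (map (x ,_) xs ++ pairs xs) G                                 ≡⟨ Σℚ-++ (map (x ,_) xs) (pairs xs) G ⟩
  Σℚ (map (x ,_) xs) G + Σℚ (pairs xs) G                           ≡⟨ cong₂ _+_ row (Σℚ-pairs xs F) ⟩
  (Σℚ xs (F x) + Σℚ xs (λ y → F y x)) + (all - diag)               ≡⟨ regroup (Σℚ xs (F x)) (Σℚ xs (λ y → F y x)) (F x x) all diag ⟩
  ((F x x + Σℚ xs (F x)) + (Σℚ xs (λ y → F y x) + all)) - (F x x + diag)
    ≡⟨ cong (λ t → ((F x x + Σℚ xs (F x)) + t) - (F x x + diag)) (Σℚ-+ xs (λ y → F y x) (λ y → Σℚ xs (F y))) ⟨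
  ((F x x + Σℚ xs (F x)) + Σℚ xs (λ y → F y x + Σℚ xs (F y))) - (F x x + diag) ∎
  where
  open ≡-Reasoning
  G : _ → ℚ
  G p = F (proj₁ p) (proj₂ p) + F (proj₂ p) (proj₁ p)
  all diag : ℚ
  all  = Σℚ xs (λ y → Σℚ xs (F y))
  diag = Σℚ xs (λ y → F y y)
  row : Σℚ (map (x ,_) xs) G ≡ Σℚ xs (F x) + Σℚ xs (λ y → F y x)
  row = trans (Σℚ-map (x ,_) xs G) (Σℚ-+ xs (F x) (λ y → F y x))
  regroup : ∀ a b c s d → (a + b) + (s - d) ≡ ((c + a) + (b + s)) - (c + d)
  regroup = solve 5 (λ a b c s d → (a :+ b) :+ (s :- d) := ((c :+ a) :+ (b :+ s)) :- (c :+ d)) refl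

sumFin : (n : ℕ) → (Fin n → ℚ) → ℚ
sumFin zero    f = 0ℚ
sumFin (suc n) f = f zero + sumFin n (f ∘ suc)

Σℚ-allFin : (n : ℕ) (f : Fin n → ℚ) → Σℚ (allFin n) f ≡ sumFin n f
Σℚ-allFin n f = go n (λ i → i) f
  where
  go : {A : Set} (n : ℕ) (g : Fin n → A) (f : A → ℚ) → Σℚ (tabulate g) f ≡ sumFin n (f ∘ g)
  go zero    g f = refl
  go (suc n) g f = cong (f (g zero) +_) (go n (g ∘ suc) f)

sumFin-cong : ∀ n {f g : Fin n → ℚ} → (∀ i → f i ≡ g i) → sumFin n f ≡ sumFin n g
sumFin-cong zero    f≗g = refl
sumFin-cong (suc n) f≗g = cong₂ _+_ (f≗g zero) (sumFin-cong n (f≗g ∘ suc))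

sumFin-const : ∀ n c → sumFin n (λ _ → c) ≡ toℚ n * c
sumFin-const zero    c = sym (ℚP.*-zeroˡ c)
sumFin-const (suc n) c = trans (cong (c +_) (sumFin-const n c))
  (solve 2 (λ c l → c :+ l :* c := (con 1ℚ :+ l) :* c) refl c (toℚ n))

sumFin-+ : ∀ n (f g : Fin n → ℚ) → sumFin n (λ i → f i + g i) ≡ sumFin n f + sumFin n g
sumFin-+ zero    f g = refl
sumFin-+ (suc n) f g = trans (cong (f zero + g zero +_) (sumFin-+ n (f ∘ suc) (g ∘ suc)))
  (solve 4 (λ a b c d → (a :+ b) :+ (c :+ d) := (a :+ c) :+ (b :+ d)) refl
     (f zero) (g zero) (sumFin n (f ∘ suc)) (sumFin n (g ∘ suc)))

sumFin-0* : ∀ n (g : Fin n → ℚ) → sumFin n (λ i → 0ℚ * g i) ≡ 0ℚ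
sumFin-0* zero    g = refl
sumFin-0* (suc n) g = trans (cong₂ _+_ (ℚP.*-zeroˡ (g zero)) (sumFin-0* n (g ∘ suc))) (ℚP.+-identityʳ 0ℚ)

sumFin-sift : ∀ n (e g : Fin n → ℚ) (j : Fin n) → e j ≡ 1ℚ → (∀ i → ¬ i ≡ j → e i ≡ 0ℚ) →
              sumFin n (λ i → e i * g i) ≡ g j
sumFin-sift (suc n) e g zero ej e≢ = begin
  e zero * g zero + sumFin n (λ i → e (suc i) * g (suc i))   ≡⟨ cong₂ (λ a b → a * g zero + b) ej rest ⟩
  1ℚ * g zero + 0ℚ                                           ≡⟨ solve 1 (λ x → con 1ℚ :* x :+ con 0ℚ := x) refl (g zero) ⟩
  g zero                                                     ∎
  where
  open ≡-Reasoning
  rest : sumFin n (λ i → e (suc i) * g (suc i)) ≡ 0ℚ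
  rest = trans (sumFin-cong n (λ i → cong (_* g (suc i)) (e≢ (suc i) λ ()))) (sumFin-0* n (g ∘ suc))
sumFin-sift (suc n) e g (suc j) ej e≢ = begin
  e zero * g zero + sumFin n (λ i → e (suc i) * g (suc i))   ≡⟨ cong₂ (λ a b → a * g zero + b) (e≢ zero λ ()) rest ⟩
  0ℚ * g zero + g (suc j)                                    ≡⟨ solve 2 (λ x y → con 0ℚ :* x :+ y := y) refl (g zero) (g (suc j)) ⟩
  g (suc j)                                                  ∎
  where
  open ≡-Reasoning
  rest : sumFin n (λ i → e (suc i) * g (suc i)) ≡ g (suc j)
  rest = sumFin-sift n (e ∘ suc) (g ∘ suc) j ej (λ i i≢j → e≢ (suc i) (i≢j ∘ FinP.suc-injective))

sumℕ : ℕ → (ℕ → ℚ) → ℚ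
sumℕ zero    f = 0ℚ
sumℕ (suc n) f = f zero + sumℕ n (f ∘ suc)

sumFin-toℕ : ∀ n f → sumFin n (f ∘ toℕ) ≡ sumℕ n f
sumFin-toℕ zero    f = refl
sumFin-toℕ (suc n) f = cong (f zero +_) (sumFin-toℕ n (f ∘ suc))

sumℕ-cong : ∀ n {f g : ℕ → ℚ} → (∀ d → f d ≡ g d) → sumℕ n f ≡ sumℕ n g
sumℕ-cong zero    f≗g = refl
sumℕ-cong (suc n) f≗g = cong₂ _+_ (f≗g zero) (sumℕ-cong n (f≗g ∘ suc))

sumℕ-+ : ∀ n (f g : ℕ → ℚ) → sumℕ n (λ d → f d + g d) ≡ sumℕ n f + sumℕ n g
sumℕ-+ zero    f g = refl
sumℕ-+ (suc n) f g = trans (cong (f zero + g zero +_) (sumℕ-+ n (f ∘ suc) (g ∘ suc)))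
  (solve 4 (λ a b c d → (a :+ b) :+ (c :+ d) := (a :+ c) :+ (b :+ d)) refl
     (f zero) (g zero) (sumℕ n (f ∘ suc)) (sumℕ n (g ∘ suc)))

sumℕ-snoc : ∀ n f → sumℕ (suc n) f ≡ sumℕ n f + f n
sumℕ-snoc zero    f = ℚP.+-comm (f zero) 0ℚ
sumℕ-snoc (suc n) f = trans (cong (f zero +_) (sumℕ-snoc n (f ∘ suc)))
  (sym (ℚP.+-assoc (f zero) (sumℕ n (f ∘ suc)) (f (suc n))))

sq : ℚ → ℚ
sq x = x * x

sq-nonNeg : ∀ x → 0ℚ ≤ℚ sq x
sq-nonNeg x with ℚP.≤-total 0ℚ x
... | inj₁ 0≤x = ℚP.nonNegative⁻¹ (x * x) {{ℚP.nonNeg*nonNeg⇒nonNeg x {{ℚ.nonNegative 0≤x}} x {{ℚ.nonNegative 0≤x}}}}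
... | inj₂ x≤0 = ℚP.nonNegative⁻¹ (x * x) {{ℚP.nonPos*nonPos⇒nonPos x {{ℚ.nonPositive x≤0}} x {{ℚ.nonPositive x≤0}}}}

sq≡0⇒≡0 : ∀ x → sq x ≡ 0ℚ → x ≡ 0ℚ
sq≡0⇒≡0 x xx≡0 with x ℚP.≟ 0ℚ
... | yes x≡0 = x≡0
... | no  x≢0 = ⊥-elim (x≢0 (begin
  x                 ≡⟨ ℚP.*-identityˡ x ⟨
  1ℚ * x            ≡⟨ cong (_* x) (ℚP.*-inverseˡ x) ⟨
  (1/ x * x) * x    ≡⟨ ℚP.*-assoc (1/ x) x x ⟩
  1/ x * (x * x)    ≡⟨ cong (1/ x *_) xx≡0 ⟩
  1/ x * 0ℚ         ≡⟨ ℚP.*-zeroʳ (1/ x) ⟩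
  0ℚ                ∎))
  where
  open ≡-Reasoning
  instance _ = ℚ.≢-nonZero x≢0

sq-diff≡0⇒≡ : ∀ x y → sq (x - y) ≡ 0ℚ → x ≡ y
sq-diff≡0⇒≡ x y e = begin
  x             ≡⟨ solve 2 (λ x y → x := (x :- y) :+ y) refl x y ⟩
  (x - y) + y   ≡⟨ cong (_+ y) (sq≡0⇒≡0 (x - y) e) ⟩
  0ℚ + y        ≡⟨ ℚP.+-identityˡ y ⟩
  y             ∎
  where open ≡-Reasoning

nonNeg+nonNeg≡0 : ∀ {a b} → 0ℚ ≤ℚ a → 0ℚ ≤ℚ b → a + b ≡ 0ℚ → a ≡ 0ℚ × b ≡ 0ℚ
nonNeg+nonNeg≡0 {a} {b} 0≤a 0≤b a+b≡0 =
  ℚP.≤-antisym (subst (a ≤ℚ_) a+b≡0 (subst (_≤ℚ a + b) (ℚP.+-identityʳ a) (ℚP.+-monoʳ-≤ a 0≤b))) 0≤a ,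
  ℚP.≤-antisym (subst (b ≤ℚ_) a+b≡0 (subst (_≤ℚ a + b) (ℚP.+-identityˡ b) (ℚP.+-monoˡ-≤ b 0≤a))) 0≤b

Σℚ-sq≡0 : {A : Set} (xs : List A) (f : A → ℚ) → Σℚ xs (sq ∘ f) ≡ 0ℚ → All (λ a → sq (f a) ≡ 0ℚ) xs
Σℚ-sq≡0 []       f _ = []
Σℚ-sq≡0 (x ∷ xs) f Σ≡0 with nonNeg+nonNeg≡0 (sq-nonNeg (f x)) (Σℚ-nonNeg xs) Σ≡0
  where
  Σℚ-nonNeg : ∀ ys → 0ℚ ≤ℚ Σℚ ys (sq ∘ f)
  Σℚ-nonNeg []       = ℚP.≤-refl
  Σℚ-nonNeg (y ∷ ys) = ℚP.+-mono-≤ (sq-nonNeg (f y)) (Σℚ-nonNeg ys)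
... | fx² , rest = fx² ∷ Σℚ-sq≡0 xs f rest

-- Lets the ring solver prove identities that hold only modulo a relation x = y.
≡-modulo : ∀ {lhs rhs w x y : ℚ} → lhs ≡ rhs + w * (x - y) → x ≡ y → lhs ≡ rhs
≡-modulo {rhs = rhs} {w} {x} eq refl = trans eq (solve 3 (λ r w x → r :+ w :* (x :- x) := r) refl rhs w x)

*-cancelʳ : ∀ x y z → ¬ z ≡ 0ℚ → x * z ≡ y * z → x ≡ y
*-cancelʳ x y z z≢0 xz≡yz = begin
  x                  ≡⟨ ℚP.*-identityʳ x ⟨
  x * 1ℚ             ≡⟨ cong (x *_) (ℚP.*-inverseʳ z) ⟨
  x * (z * 1/ z)     ≡⟨ ℚP.*-assoc x z (1/ z) ⟨
  (x * z) * 1/ z     ≡⟨ cong (_* 1/ z) xz≡yz ⟩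
  (y * z) * 1/ z     ≡⟨ ℚP.*-assoc y z (1/ z) ⟩
  y * (z * 1/ z)     ≡⟨ cong (y *_) (ℚP.*-inverseʳ z) ⟩
  y * 1ℚ             ≡⟨ ℚP.*-identityʳ y ⟩
  y                  ∎
  where
  open ≡-Reasoning
  instance _ = ℚ.≢-nonZero z≢0

-- Effective resistance on a finite graph

module GraphFacts {V : Set} (_≟_ : (a b : V) → Dec (a ≡ b))
                  (vertices : List V) (edges : List (V × V)) where

  open Graph _≟_ vertices edges

  δ-refl : ∀ a → δ a a ≡ 1ℚ
  δ-refl a with a ≟ a
  ... | yes _   = refl
  ... | no  a≢a = ⊥-elim (a≢a refl)

  δ-≢ : ∀ a b → ¬ a ≡ b → δ a b ≡ 0ℚ
  δ-≢ a b a≢b with a ≟ b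
  ... | yes a≡b = ⊥-elim (a≢b a≡b)
  ... | no  _   = refl

  Lap-cong : ∀ {x y : V → ℚ} → (∀ a → x a ≡ y a) → ∀ w → Lap x w ≡ Lap y w
  Lap-cong x≗y w = Σℚ-cong edges λ { (a , b) → cong₂ (λ s t → δ w a * (s - t) + δ w b * (t - s)) (x≗y a) (x≗y b) }

  Lap-- : ∀ (x y : V → ℚ) w → Lap (λ a → x a - y a) w ≡ Lap x w - Lap y w
  Lap-- x y w = trans (Σℚ-cong edges edge) (Σℚ-- edges (edgeTerm x w) (edgeTerm y w))
    where
    edge : ∀ e → edgeTerm (λ a → x a - y a) w e ≡ edgeTerm x w e - edgeTerm y w e
    edge (a , b) = solve 6 (λ da db xa xb ya yb →
        da :* ((xa :- ya) :- (xb :- yb)) :+ db :* ((xb :- yb) :- (xa :- ya))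
        := (da :* (xa :- xb) :+ db :* (xb :- xa)) :- (da :* (ya :- yb) :+ db :* (yb :- ya)))
      refl (δ w a) (δ w b) (x a) (x b) (y a) (y b)

  -- Connectivity, in the form used here: harmonic functions are constant.
  Connected : Set
  Connected = ∀ (z : V → ℚ) → (∀ w → Lap z w ≡ 0ℚ) → ∀ a b → z a ≡ z b

  IsEffRes-unique : Connected → ∀ {u v r s} → IsEffRes u v r → IsEffRes u v s → r ≡ s
  IsEffRes-unique conn {u} {v} {r} {s} (x , Lx , r≡) (y , Ly , s≡) = begin
    r                          ≡⟨ r≡ ⟩
    x u - x v                  ≡⟨ solve 4 (λ xu xv yu yv → xu :- xv := ((xu :- yu) :- (xv :- yv)) :+ (yu :- yv)) refl (x u) (x v) (y u) (y v) ⟩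
    (z u - z v) + (y u - y v)  ≡⟨ cong (λ t → (t - z v) + (y u - y v)) (conn z harmonic u v) ⟩
    (z v - z v) + (y u - y v)  ≡⟨ solve 3 (λ a b c → (a :- a) :+ (b :- c) := b :- c) refl (z v) (y u) (y v) ⟩
    y u - y v                  ≡⟨ s≡ ⟨
    s                          ∎
    where
    open ≡-Reasoning
    z : V → ℚ
    z a = x a - y a
    harmonic : ∀ w → Lap z w ≡ 0ℚ
    harmonic w = begin
      Lap z w                                  ≡⟨ Lap-- x y w ⟩
      Lap x w - Lap y w                        ≡⟨ cong₂ _-_ (Lx w) (Ly w) ⟩
      (δ u w - δ v w) - (δ u w - δ v w)        ≡⟨ ℚP.+-inverseʳ (δ u w - δ v w) ⟩
      0ℚ                                       ∎

  -- The effective resistance when g s is the potential of a unit current entering at s and leaving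
  -- uniformly through all vertices.
  greenRes : (V → V → ℚ) → V → V → ℚ
  greenRes g a b = (g a a - g b a) - (g a b - g b b)

  greenRes-isResistanceFn : ∀ (g : V → V → ℚ) c → (∀ s w → Lap (g s) w ≡ δ s w - c) →
                            IsResistanceFn (greenRes g)
  greenRes-isResistanceFn g c Lg a b = (λ w → g a w - g b w) , L , refl
    where
    L : ∀ w → Lap (λ t → g a t - g b t) w ≡ δ a w - δ b w
    L w = trans (Lap-- (g a) (g b) w) (trans (cong₂ _-_ (Lg a w) (Lg b w))
            (solve 3 (λ x y c → (x :- c) :- (y :- c) := x :- y) refl (δ a w) (δ b w) c))

  Kf-greenRes : ∀ (g : V → V → ℚ) T → (∀ s → Σℚ vertices (g s) ≡ T) →
                Kf (greenRes g) ≡ toℚ (length vertices) * (Σℚ vertices (λ a → g a a) - T)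
  Kf-greenRes g T rows = begin
    Kf (greenRes g)                                           ≡⟨ Σℚ-cong (pairs vertices) (λ p → split (proj₁ p) (proj₂ p)) ⟩
    Σℚ (pairs vertices) (λ p → F (proj₁ p) (proj₂ p) + F (proj₂ p) (proj₁ p))
                                                              ≡⟨ Σℚ-pairs vertices F ⟩
    Σℚ vertices (λ a → Σℚ vertices (F a)) - Σℚ vertices (λ a → F a a)
                                                              ≡⟨ cong₂ _-_ (Σℚ-cong vertices (λ a → Σℚ-- vertices (λ _ → g a a) (λ b → g b a)))
                                                                           (trans (Σℚ-cong vertices (λ a → ℚP.+-inverseʳ (g a a))) (Σℚ-zero vertices)) ⟩
    Σℚ vertices (λ a → Σℚ vertices (λ _ → g a a) - Σℚ vertices (λ b → g b a)) - 0ℚ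
                                                              ≡⟨ cong (_- 0ℚ) (Σℚ-- vertices (λ a → Σℚ vertices (λ _ → g a a))
                                                                                            (λ a → Σℚ vertices (λ b → g b a))) ⟩
    (Σℚ vertices (λ a → Σℚ vertices (λ _ → g a a)) - Σℚ vertices (λ a → Σℚ vertices (λ b → g b a))) - 0ℚ
                                                              ≡⟨ cong₂ (λ s t → (s - t) - 0ℚ) diagonal columns ⟩
    (|V| * D - |V| * T) - 0ℚ                                  ≡⟨ solve 3 (λ v d t → (v :* d :- v :* t) :- con 0ℚ := v :* (d :- t)) refl |V| D T ⟩
    |V| * (D - T)                                             ∎
    where
    open ≡-Reasoning
    |V| D : ℚ
    |V| = toℚ (length vertices)
    D   = Σℚ vertices (λ a → g a a)
    F : V → V → ℚ
    F a b = g a a - g b a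
    split : ∀ a b → greenRes g a b ≡ F a b + F b a
    split a b = solve 4 (λ aa ba ab bb → (aa :- ba) :- (ab :- bb) := (aa :- ba) :+ (bb :- ab)) refl
                  (g a a) (g b a) (g a b) (g b b)
    diagonal : Σℚ vertices (λ a → Σℚ vertices (λ _ → g a a)) ≡ |V| * D
    diagonal = trans (Σℚ-cong vertices (λ a → Σℚ-const vertices (g a a))) (Σℚ-*ˡ vertices |V| (λ a → g a a))
    columns : Σℚ vertices (λ a → Σℚ vertices (λ b → g b a)) ≡ |V| * T
    columns = trans (Σℚ-swap vertices vertices (λ a b → g b a))
                (trans (Σℚ-cong vertices rows) (Σℚ-const vertices T))

  -- The Dirichlet energy identity; it needs every vertex listed exactly once, expressed as sifting.
  module _ (sift : ∀ a (f : V → ℚ) → Σℚ vertices (λ w → δ w a * f w) ≡ f a) where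

    energy : ∀ (z : V → ℚ) → Σℚ vertices (λ w → z w * Lap z w) ≡ Σℚ edges (λ e → sq (z (proj₁ e) - z (proj₂ e)))
    energy z = begin
      Σℚ vertices (λ w → z w * Lap z w)                                 ≡⟨ Σℚ-cong vertices (λ w → sym (Σℚ-*ˡ edges (z w) (edgeTerm z w))) ⟩
      Σℚ vertices (λ w → Σℚ edges (λ e → z w * edgeTerm z w e))         ≡⟨ Σℚ-swap vertices edges (λ w e → z w * edgeTerm z w e) ⟩
      Σℚ edges (λ e → Σℚ vertices (λ w → z w * edgeTerm z w e))         ≡⟨ Σℚ-cong edges edge ⟩
      Σℚ edges (λ e → sq (z (proj₁ e) - z (proj₂ e)))                   ∎
      where
      open ≡-Reasoning
      edge : ∀ e → Σℚ vertices (λ w → z w * edgeTerm z w e) ≡ sq (z (proj₁ e) - z (proj₂ e))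
      edge (a , b) = begin
        Σℚ vertices (λ w → z w * (δ w a * (z a - z b) + δ w b * (z b - z a)))
          ≡⟨ Σℚ-cong vertices (λ w → solve 5 (λ zw da db za zb →
               zw :* (da :* (za :- zb) :+ db :* (zb :- za)) := da :* (zw :* (za :- zb)) :+ db :* (zw :* (zb :- za)))
               refl (z w) (δ w a) (δ w b) (z a) (z b)) ⟩
        Σℚ vertices (λ w → δ w a * (z w * (z a - z b)) + δ w b * (z w * (z b - z a)))
          ≡⟨ Σℚ-+ vertices (λ w → δ w a * (z w * (z a - z b))) (λ w → δ w b * (z w * (z b - z a))) ⟩
        Σℚ vertices (λ w → δ w a * (z w * (z a - z b))) + Σℚ vertices (λ w → δ w b * (z w * (z b - z a)))
          ≡⟨ cong₂ _+_ (sift a (λ w → z w * (z a - z b))) (sift b (λ w → z w * (z b - z a))) ⟩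
        z a * (z a - z b) + z b * (z b - z a)
          ≡⟨ solve 2 (λ x y → x :* (x :- y) :+ y :* (y :- x) := (x :- y) :* (x :- y)) refl (z a) (z b) ⟩
        sq (z a - z b)                                                  ∎

    harmonic⇒edgewise-constant : ∀ (z : V → ℚ) → (∀ w → Lap z w ≡ 0ℚ) →
                                 All (λ e → z (proj₁ e) ≡ z (proj₂ e)) edges
    harmonic⇒edgewise-constant z harmonic = All.map (λ {e} → sq-diff≡0⇒≡ (z (proj₁ e)) (z (proj₂ e)))
      (Σℚ-sq≡0 edges (λ e → z (proj₁ e) - z (proj₂ e)) (begin
      Σℚ edges (λ e → sq (z (proj₁ e) - z (proj₂ e)))   ≡⟨ energy z ⟨
      Σℚ vertices (λ w → z w * Lap z w)                 ≡⟨ Σℚ-cong vertices (λ w → trans (cong (z w *_) (harmonic w)) (ℚP.*-zeroʳ (z w))) ⟩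
      Σℚ vertices (λ _ → 0ℚ)                            ≡⟨ Σℚ-zero vertices ⟩
      0ℚ                                                ∎))
      where open ≡-Reasoning

-- Distance around a cycle

module Cyclic (k : ℕ) where

  private
    n : ℕ
    n = suc k

  sucMod : ℕ → ℕ
  sucMod d = suc d % n

  predMod : ℕ → ℕ
  predMod zero    = k
  predMod (suc d) = d

  sucMod-cases : ∀ d → d < n → (sucMod d ≡ suc d × suc d < n) ⊎ (sucMod d ≡ 0 × d ≡ k)
  sucMod-cases d d<n with ℕP.m≤n⇒m<n∨m≡n d<n
  ... | inj₁ d+1<n = inj₁ (m<n⇒m%n≡m d+1<n , d+1<n)
  ... | inj₂ d+1≡n = inj₂ (trans (cong (_% n) d+1≡n) (n%n≡0 n) , ℕP.suc-injective d+1≡n)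

  predMod-sucMod : ∀ d → d < n → predMod (sucMod d) ≡ d
  predMod-sucMod d d<n with sucMod-cases d d<n
  ... | inj₁ (eq , _)   = cong predMod eq
  ... | inj₂ (eq , d≡k) = trans (cong predMod eq) (sym d≡k)

  sucMod-predMod : ∀ d → d < n → sucMod (predMod d) ≡ d
  sucMod-predMod zero    _   = n%n≡0 n
  sucMod-predMod (suc d) d<n = m<n⇒m%n≡m d<n

  sumℕ-predMod : ∀ f → sumℕ n (f ∘ predMod) ≡ sumℕ n f
  sumℕ-predMod f = trans (ℚP.+-comm (f k) (sumℕ k f)) (sym (sumℕ-snoc k f))

  %-absorbˡ : ∀ a b → ((a % n) ℕ.+ b) % n ≡ (a ℕ.+ b) % n
  %-absorbˡ a b = begin
    ((a % n) ℕ.+ b) % n               ≡⟨ %-distribˡ-+ (a % n) b n ⟩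
    ((a % n % n) ℕ.+ (b % n)) % n     ≡⟨ cong (λ t → (t ℕ.+ (b % n)) % n) (m%n%n≡m%n a n) ⟩
    ((a % n) ℕ.+ (b % n)) % n         ≡⟨ %-distribˡ-+ a b n ⟨
    (a ℕ.+ b) % n                     ∎
    where open ≡-Reasoning

  sucMod-% : ∀ x → sucMod (x % n) ≡ sucMod x
  sucMod-% x = begin
    suc (x % n) % n       ≡⟨ cong (_% n) (ℕP.+-comm 1 (x % n)) ⟩
    ((x % n) ℕ.+ 1) % n   ≡⟨ %-absorbˡ x 1 ⟩
    (x ℕ.+ 1) % n         ≡⟨ cong (_% n) (ℕP.+-comm x 1) ⟩
    suc x % n             ∎
    where open ≡-Reasoning

  toℕ-next : (i : Fin n) → toℕ (next i) ≡ sucMod (toℕ i)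
  toℕ-next i = FinP.toℕ-fromℕ< _

  next-induction : (C : Fin n → Set) → C zero → (∀ i → C i → C (next i)) → ∀ i → C i
  next-induction C C0 Cnext i = subst C (FinP.fromℕ<-toℕ i (FinP.toℕ<n i)) (go (toℕ i) (FinP.toℕ<n i))
    where
    go : ∀ d (d<n : d < n) → C (fromℕ< d<n)
    go zero    _   = C0
    go (suc d) d<n = subst C next≡ (Cnext (fromℕ< d<n′) (go d d<n′))
      where
      d<n′ : d < n
      d<n′ = ℕP.<-trans (ℕP.n<1+n d) d<n
      next≡ : next (fromℕ< d<n′) ≡ fromℕ< d<n
      next≡ = FinP.toℕ-injective (begin
        toℕ (next (fromℕ< d<n′))     ≡⟨ toℕ-next (fromℕ< d<n′) ⟩
        suc (toℕ (fromℕ< d<n′)) % n  ≡⟨ cong (λ t → suc t % n) (FinP.toℕ-fromℕ< d<n′) ⟩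
        suc d % n                    ≡⟨ m<n⇒m%n≡m d<n ⟩
        suc d                        ≡⟨ FinP.toℕ-fromℕ< d<n ⟨
        toℕ (fromℕ< d<n)             ∎)
        where open ≡-Reasoning

  -- Number of steps of next from i to j.
  dist : Fin n → Fin n → ℕ
  dist i j = (toℕ j ℕ.+ (n ∸ toℕ i)) % n

  dist<n : ∀ i j → dist i j < n
  dist<n i j = m%n<n (toℕ j ℕ.+ (n ∸ toℕ i)) n

  dist-refl : ∀ i → dist i i ≡ 0
  dist-refl i = trans (cong (_% n) (ℕP.m+[n∸m]≡n (ℕP.<⇒≤ (FinP.toℕ<n i)))) (n%n≡0 n)

  dist-zeroˡ : ∀ j → dist zero j ≡ toℕ j
  dist-zeroˡ j = trans ([m+n]%n≡m%n (toℕ j) n) (m<n⇒m%n≡m (FinP.toℕ<n j))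

  dist-nextʳ : ∀ i j → dist i (next j) ≡ sucMod (dist i j)
  dist-nextʳ i j = begin
    (toℕ (next j) ℕ.+ c) % n        ≡⟨ cong (λ t → (t ℕ.+ c) % n) (toℕ-next j) ⟩
    ((suc (toℕ j) % n) ℕ.+ c) % n   ≡⟨ %-absorbˡ (suc (toℕ j)) c ⟩
    suc (toℕ j ℕ.+ c) % n           ≡⟨ sucMod-% (toℕ j ℕ.+ c) ⟨
    suc ((toℕ j ℕ.+ c) % n) % n     ∎
    where
    open ≡-Reasoning
    c : ℕ
    c = n ∸ toℕ i

  dist-nextˡ : ∀ i j → dist i j ≡ sucMod (dist (next i) j)
  dist-nextˡ i j with ℕP.m≤n⇒m<n∨m≡n (FinP.toℕ<n i)
  ... | inj₁ i+1<n = sym (begin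
    suc ((toℕ j ℕ.+ (n ∸ toℕ (next i))) % n) % n  ≡⟨ sucMod-% (toℕ j ℕ.+ (n ∸ toℕ (next i))) ⟩
    suc (toℕ j ℕ.+ (n ∸ toℕ (next i))) % n        ≡⟨ cong (λ t → suc (toℕ j ℕ.+ (n ∸ t)) % n) (trans (toℕ-next i) (m<n⇒m%n≡m i+1<n)) ⟩
    suc (toℕ j ℕ.+ (n ∸ suc (toℕ i))) % n         ≡⟨ cong (_% n) (ℕP.+-suc (toℕ j) _) ⟨
    (toℕ j ℕ.+ suc (n ∸ suc (toℕ i))) % n         ≡⟨ cong (λ t → (toℕ j ℕ.+ t) % n) (ℕP.+-∸-assoc 1 (ℕP.≤-pred (FinP.toℕ<n i))) ⟨
    (toℕ j ℕ.+ (n ∸ toℕ i)) % n                   ∎)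
    where open ≡-Reasoning
  ... | inj₂ i+1≡n = begin
    (toℕ j ℕ.+ (n ∸ toℕ i)) % n                   ≡⟨ cong (λ t → (toℕ j ℕ.+ t) % n) n∸i≡1 ⟩
    (toℕ j ℕ.+ 1) % n                           ≡⟨ cong (_% n) (ℕP.+-comm (toℕ j) 1) ⟩
    suc (toℕ j) % n                             ≡⟨ [m+n]%n≡m%n (suc (toℕ j)) n ⟨
    suc (toℕ j ℕ.+ n) % n                         ≡⟨ cong (λ t → suc (toℕ j ℕ.+ (n ∸ t)) % n) next≡0 ⟨
    suc (toℕ j ℕ.+ (n ∸ toℕ (next i))) % n        ≡⟨ sucMod-% (toℕ j ℕ.+ (n ∸ toℕ (next i))) ⟨
    suc ((toℕ j ℕ.+ (n ∸ toℕ (next i))) % n) % n  ∎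
    where
    open ≡-Reasoning
    n∸i≡1 : n ∸ toℕ i ≡ 1
    n∸i≡1 = trans (cong (_∸ toℕ i) (sym i+1≡n)) (ℕP.m+n∸n≡m 1 (toℕ i))
    next≡0 : toℕ (next i) ≡ 0
    next≡0 = trans (toℕ-next i) (trans (cong (_% n) i+1≡n) (n%n≡0 n))

  prev : Fin n → Fin n
  prev j = fromℕ< (dist<n (next zero) j)

  toℕ-prev : ∀ j → toℕ (prev j) ≡ predMod (toℕ j)
  toℕ-prev j = begin
    toℕ (prev j)                            ≡⟨ FinP.toℕ-fromℕ< _ ⟩
    dist (next zero) j                      ≡⟨ predMod-sucMod _ (dist<n (next zero) j) ⟨
    predMod (sucMod (dist (next zero) j))   ≡⟨ cong predMod (trans (sym (dist-nextˡ zero j)) (dist-zeroˡ j)) ⟩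
    predMod (toℕ j)                         ∎
    where open ≡-Reasoning

  next-prev : ∀ j → next (prev j) ≡ j
  next-prev j = FinP.toℕ-injective (trans (toℕ-next (prev j))
    (trans (cong (λ t → suc t % n) (toℕ-prev j)) (sucMod-predMod (toℕ j) (FinP.toℕ<n j))))

  prev-next : ∀ i → prev (next i) ≡ i
  prev-next i = FinP.toℕ-injective (trans (toℕ-prev (next i))
    (trans (cong predMod (toℕ-next i)) (predMod-sucMod (toℕ i) (FinP.toℕ<n i))))

  dist-prevʳ : ∀ i j → dist i j ≡ sucMod (dist i (prev j))
  dist-prevʳ i j = trans (cong (dist i) (sym (next-prev j))) (dist-nextʳ i (prev j))

  dist-prev-next : ∀ i j → dist i (prev j) ≡ dist (next i) j
  dist-prev-next i j = begin
    dist i (prev j)                     ≡⟨ predMod-sucMod _ (dist<n i (prev j)) ⟨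
    predMod (sucMod (dist i (prev j)))  ≡⟨ cong predMod (dist-prevʳ i j) ⟨
    predMod (dist i j)                  ≡⟨ cong predMod (dist-nextˡ i j) ⟩
    predMod (sucMod (dist (next i) j))  ≡⟨ predMod-sucMod _ (dist<n (next i) j) ⟩
    dist (next i) j                     ∎
    where open ≡-Reasoning

  dist≡0⇒≡ : ∀ i j → dist i j ≡ 0 → i ≡ j
  dist≡0⇒≡ = next-induction (λ i → ∀ j → dist i j ≡ 0 → i ≡ j) base step
    where
    base : ∀ j → dist zero j ≡ 0 → zero ≡ j
    base j d≡0 = FinP.toℕ-injective (sym (trans (sym (dist-zeroˡ j)) d≡0))
    step : ∀ i → (∀ j → dist i j ≡ 0 → i ≡ j) → ∀ j → dist (next i) j ≡ 0 → next i ≡ j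
    step i ih j d≡0 = trans (cong next (ih (prev j) (trans (dist-prev-next i j) d≡0))) (next-prev j)

  sumFin-dist : ∀ i (f : ℕ → ℚ) → sumFin n (λ j → f (dist i j)) ≡ sumℕ n f
  sumFin-dist = next-induction (λ i → ∀ f → sumFin n (λ j → f (dist i j)) ≡ sumℕ n f) base step
    where
    base : ∀ f → sumFin n (λ j → f (dist zero j)) ≡ sumℕ n f
    base f = trans (sumFin-cong n (λ j → cong f (dist-zeroˡ j))) (sumFin-toℕ n f)
    step : ∀ i → (∀ f → sumFin n (λ j → f (dist i j)) ≡ sumℕ n f) →
           ∀ f → sumFin n (λ j → f (dist (next i) j)) ≡ sumℕ n f
    step i ih f = begin
      sumFin n (λ j → f (dist (next i) j))                    ≡⟨ sumFin-cong n (λ j → cong f (predMod-sucMod _ (dist<n (next i) j))) ⟨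
      sumFin n (λ j → f (predMod (sucMod (dist (next i) j)))) ≡⟨ sumFin-cong n (λ j → cong (f ∘ predMod) (dist-nextˡ i j)) ⟨
      sumFin n (λ j → f (predMod (dist i j)))                 ≡⟨ ih (f ∘ predMod) ⟩
      sumℕ n (f ∘ predMod)                                    ≡⟨ sumℕ-predMod f ⟩
      sumℕ n f                                                ∎
      where open ≡-Reasoning

-- Pell numbers

-- (3 + √8)ᵏ = uₖ + vₖ √8.
uℕ vℕ : ℕ → ℕ
uℕ zero    = 1
uℕ (suc k) = 3 ℕ.* uℕ k ℕ.+ 8 ℕ.* vℕ k
vℕ zero    = 0
vℕ (suc k) = uℕ k ℕ.+ 3 ℕ.* vℕ k

u v : ℕ → ℚ
u k = toℚ (uℕ k)
v k = toℚ (vℕ k)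

u-suc : ∀ k → u (suc k) ≡ ℕtoℚ 3 * u k + ℕtoℚ 8 * v k
u-suc k = trans (toℚ-+ (3 ℕ.* uℕ k) (8 ℕ.* vℕ k)) (cong₂ _+_ (toℚ-* 3 (uℕ k)) (toℚ-* 8 (vℕ k)))

v-suc : ∀ k → v (suc k) ≡ u k + ℕtoℚ 3 * v k
v-suc k = trans (toℚ-+ (uℕ k) (3 ℕ.* vℕ k)) (cong (u k +_) (toℚ-* 3 (vℕ k)))

u-rec : ∀ k → u k + u (suc (suc k)) ≡ ℕtoℚ 6 * u (suc k)
u-rec k = begin
  u k + u (suc (suc k))
    ≡⟨ cong (u k +_) (trans (u-suc (suc k)) (cong₂ (λ a b → ℕtoℚ 3 * a + ℕtoℚ 8 * b) (u-suc k) (v-suc k))) ⟩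
  u k + (ℕtoℚ 3 * (ℕtoℚ 3 * u k + ℕtoℚ 8 * v k) + ℕtoℚ 8 * (u k + ℕtoℚ 3 * v k))
    ≡⟨ solve 2 (λ x y → x :+ (lit 3 :* (lit 3 :* x :+ lit 8 :* y) :+ lit 8 :* (x :+ lit 3 :* y))
                        := lit 6 :* (lit 3 :* x :+ lit 8 :* y)) refl (u k) (v k) ⟩
  ℕtoℚ 6 * (ℕtoℚ 3 * u k + ℕtoℚ 8 * v k)
    ≡⟨ cong (ℕtoℚ 6 *_) (u-suc k) ⟨
  ℕtoℚ 6 * u (suc k)
    ∎
  where open ≡-Reasoning

-- Multiplying by 3 − √8 steps back.
u-pred : ∀ k → ℕtoℚ 3 * u (suc k) - u k ≡ ℕtoℚ 8 * v (suc k)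
u-pred k = begin
  ℕtoℚ 3 * u (suc k) - u k                          ≡⟨ cong (λ t → ℕtoℚ 3 * t - u k) (u-suc k) ⟩
  ℕtoℚ 3 * (ℕtoℚ 3 * u k + ℕtoℚ 8 * v k) - u k      ≡⟨ solve 2 (λ x y → lit 3 :* (lit 3 :* x :+ lit 8 :* y) :- x
                                                         := lit 8 :* (x :+ lit 3 :* y)) refl (u k) (v k) ⟩
  ℕtoℚ 8 * (u k + ℕtoℚ 3 * v k)                     ≡⟨ cong (ℕtoℚ 8 *_) (v-suc k) ⟨
  ℕtoℚ 8 * v (suc k)                                ∎
  where open ≡-Reasoning

pell : ∀ k → u k * u k - ℕtoℚ 8 * (v k * v k) ≡ 1ℚ
pell zero    = refl
pell (suc k) = begin
  u (suc k) * u (suc k) - ℕtoℚ 8 * (v (suc k) * v (suc k))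
    ≡⟨ cong₂ (λ a b → a * a - ℕtoℚ 8 * (b * b)) (u-suc k) (v-suc k) ⟩
  (ℕtoℚ 3 * u k + ℕtoℚ 8 * v k) * (ℕtoℚ 3 * u k + ℕtoℚ 8 * v k) - ℕtoℚ 8 * ((u k + ℕtoℚ 3 * v k) * (u k + ℕtoℚ 3 * v k))
    ≡⟨ solve 2 (λ x y → (lit 3 :* x :+ lit 8 :* y) :* (lit 3 :* x :+ lit 8 :* y)
                         :- lit 8 :* ((x :+ lit 3 :* y) :* (x :+ lit 3 :* y))
                        := x :* x :- lit 8 :* (y :* y)) refl (u k) (v k) ⟩
  u k * u k - ℕtoℚ 8 * (v k * v k)
    ≡⟨ pell k ⟩
  1ℚ ∎
  where open ≡-Reasoning

uℕ-positive : ∀ k → 1 ℕ.≤ uℕ k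
uℕ-positive zero    = s≤s z≤n
uℕ-positive (suc k) = ℕP.≤-trans (uℕ-positive k)
  (ℕP.≤-trans (ℕP.m≤m+n (uℕ k) (2 ℕ.* uℕ k)) (ℕP.m≤m+n (3 ℕ.* uℕ k) (8 ℕ.* vℕ k)))

u-suc≢1 : ∀ k → ¬ u (suc k) ≡ 1ℚ
u-suc≢1 k u≡1 with ℕtoℚ-injective {uℕ (suc k)} {1} (trans (ℕtoℚ≡toℚ (uℕ (suc k))) u≡1)
... | eq with subst (3 ℕ.≤_) eq (ℕP.≤-trans (ℕP.*-monoʳ-≤ 3 (uℕ-positive k)) (ℕP.m≤m+n (3 ℕ.* uℕ k) (8 ℕ.* vℕ k)))
... | s≤s ()

vℕ-suc-nonZero : ∀ k → ℕ.NonZero (vℕ (suc k))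
vℕ-suc-nonZero k = ℕ.>-nonZero (ℕP.≤-trans (uℕ-positive k) (ℕP.m≤m+n (uℕ k) (3 ℕ.* vℕ k)))

-- The cylinder chain Rₙ

module Chain (k : ℕ) where

  private
    n : ℕ
    n = suc k

  open Cyclic k
  open R n
  open GraphFacts (_≟V_ {n}) (RVertices n) (REdges n) public

  cell : Fin n → List (Vtx n × Vtx n)
  cell i = ((P , i) , (Q , i)) ∷ ((P , i) , (U , i)) ∷ ((U , i) , (P , next i))
         ∷ ((Q , i) , (W , i)) ∷ ((W , i) , (Q , next i)) ∷ []

  δ-kind : ∀ κ κ′ i j → δ (κ , i) (κ , j) ≡ δ (κ′ , i) (κ′ , j)
  δ-kind κ κ′ i j = by-cases (i FinP.≟ j)
    where
    by-cases : Dec (i ≡ j) → δ (κ , i) (κ , j) ≡ δ (κ′ , i) (κ′ , j)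
    by-cases (yes refl) = trans (δ-refl (κ , i)) (sym (δ-refl (κ′ , i)))
    by-cases (no i≢j)   = trans (δ-≢ (κ , i) (κ , j) (i≢j ∘ cong proj₂)) (sym (δ-≢ (κ′ , i) (κ′ , j) (i≢j ∘ cong proj₂)))

  -- At a vertex (κ , j) only the cells j and prev j contribute.
  Lap-local : ∀ x κ j (a b : Fin n → ℚ) →
    (∀ i → Σℚ (cell i) (edgeTerm x (κ , j)) ≡ δ (κ , j) (κ , i) * a i + δ (κ , j) (κ , next i) * b i) →
    Lap x (κ , j) ≡ a j + b (prev j)
  Lap-local x κ j a b cells = begin
    Lap x (κ , j)                                                 ≡⟨ Σℚ-concatMap cell (allFin n) (edgeTerm x (κ , j)) ⟩
    Σℚ (allFin n) (λ i → Σℚ (cell i) (edgeTerm x (κ , j)))        ≡⟨ Σℚ-allFin n (λ i → Σℚ (cell i) (edgeTerm x (κ , j))) ⟩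
    sumFin n (λ i → Σℚ (cell i) (edgeTerm x (κ , j)))             ≡⟨ sumFin-cong n cells ⟩
    sumFin n (λ i → at i * a i + before i * b i)                  ≡⟨ sumFin-+ n (λ i → at i * a i) (λ i → before i * b i) ⟩
    sumFin n (λ i → at i * a i) + sumFin n (λ i → before i * b i) ≡⟨ cong₂ _+_ (sumFin-sift n at a j at-j at-≢)
                                                                                 (sumFin-sift n before b (prev j) before-prev before-≢) ⟩
    a j + b (prev j)                                              ∎
    where
    open ≡-Reasoning
    at before : Fin n → ℚ
    at i     = δ (κ , j) (κ , i)
    before i = δ (κ , j) (κ , next i)
    at-j : at j ≡ 1ℚ
    at-j = δ-refl (κ , j)
    at-≢ : ∀ i → ¬ i ≡ j → at i ≡ 0ℚ
    at-≢ i i≢j = δ-≢ (κ , j) (κ , i) (λ eq → i≢j (sym (cong proj₂ eq)))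
    before-prev : before (prev j) ≡ 1ℚ
    before-prev = trans (cong (λ t → δ (κ , j) (κ , t)) (next-prev j)) (δ-refl (κ , j))
    before-≢ : ∀ i → ¬ i ≡ prev j → before i ≡ 0ℚ
    before-≢ i i≢pj = δ-≢ (κ , j) (κ , next i) (λ eq → i≢pj (trans (sym (prev-next i)) (cong prev (sym (cong proj₂ eq)))))

  module _ (x : Vtx n → ℚ) where

    LapP : ∀ j → Lap x (P , j) ≡ ((x (P , j) - x (Q , j)) + (x (P , j) - x (U , j))) + (x (P , j) - x (U , prev j))
    LapP j = trans (Lap-local x P j a b cells) (cong (λ t → a j + (x (P , t) - x (U , prev j))) (next-prev j))
      where
      a b : Fin n → ℚ
      a i = (x (P , i) - x (Q , i)) + (x (P , i) - x (U , i))
      b i = x (P , next i) - x (U , i)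
      cells : ∀ i → Σℚ (cell i) (edgeTerm x (P , j)) ≡ δ (P , j) (P , i) * a i + δ (P , j) (P , next i) * b i
      cells i = solve 8 (λ d d′ p q u w p′ q′ →
          (d :* (p :- q) :+ con 0ℚ :* (q :- p)) :+ ((d :* (p :- u) :+ con 0ℚ :* (u :- p)) :+ ((con 0ℚ :* (u :- p′) :+ d′ :* (p′ :- u))
          :+ ((con 0ℚ :* (q :- w) :+ con 0ℚ :* (w :- q)) :+ ((con 0ℚ :* (w :- q′) :+ con 0ℚ :* (q′ :- w)) :+ con 0ℚ))))
          := d :* ((p :- q) :+ (p :- u)) :+ d′ :* (p′ :- u))
        refl (δ (P , j) (P , i)) (δ (P , j) (P , next i)) (x (P , i)) (x (Q , i)) (x (U , i)) (x (W , i)) (x (P , next i)) (x (Q , next i))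

    LapQ : ∀ j → Lap x (Q , j) ≡ ((x (Q , j) - x (P , j)) + (x (Q , j) - x (W , j))) + (x (Q , j) - x (W , prev j))
    LapQ j = trans (Lap-local x Q j a b cells) (cong (λ t → a j + (x (Q , t) - x (W , prev j))) (next-prev j))
      where
      a b : Fin n → ℚ
      a i = (x (Q , i) - x (P , i)) + (x (Q , i) - x (W , i))
      b i = x (Q , next i) - x (W , i)
      cells : ∀ i → Σℚ (cell i) (edgeTerm x (Q , j)) ≡ δ (Q , j) (Q , i) * a i + δ (Q , j) (Q , next i) * b i
      cells i = solve 8 (λ d d′ p q u w p′ q′ →
          (con 0ℚ :* (p :- q) :+ d :* (q :- p)) :+ ((con 0ℚ :* (p :- u) :+ con 0ℚ :* (u :- p)) :+ ((con 0ℚ :* (u :- p′) :+ con 0ℚ :* (p′ :- u))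
          :+ ((d :* (q :- w) :+ con 0ℚ :* (w :- q)) :+ ((con 0ℚ :* (w :- q′) :+ d′ :* (q′ :- w)) :+ con 0ℚ))))
          := d :* ((q :- p) :+ (q :- w)) :+ d′ :* (q′ :- w))
        refl (δ (Q , j) (Q , i)) (δ (Q , j) (Q , next i)) (x (P , i)) (x (Q , i)) (x (U , i)) (x (W , i)) (x (P , next i)) (x (Q , next i))

    LapU : ∀ j → Lap x (U , j) ≡ (x (U , j) - x (P , j)) + (x (U , j) - x (P , next j))
    LapU j = trans (Lap-local x U j a (λ _ → 0ℚ) cells) (ℚP.+-identityʳ (a j))
      where
      a : Fin n → ℚ
      a i = (x (U , i) - x (P , i)) + (x (U , i) - x (P , next i))
      cells : ∀ i → Σℚ (cell i) (edgeTerm x (U , j)) ≡ δ (U , j) (U , i) * a i + δ (U , j) (U , next i) * 0ℚ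
      cells i = solve 8 (λ d d′ p q u w p′ q′ →
          (con 0ℚ :* (p :- q) :+ con 0ℚ :* (q :- p)) :+ ((con 0ℚ :* (p :- u) :+ d :* (u :- p)) :+ ((d :* (u :- p′) :+ con 0ℚ :* (p′ :- u))
          :+ ((con 0ℚ :* (q :- w) :+ con 0ℚ :* (w :- q)) :+ ((con 0ℚ :* (w :- q′) :+ con 0ℚ :* (q′ :- w)) :+ con 0ℚ))))
          := d :* ((u :- p) :+ (u :- p′)) :+ d′ :* con 0ℚ)
        refl (δ (U , j) (U , i)) (δ (U , j) (U , next i)) (x (P , i)) (x (Q , i)) (x (U , i)) (x (W , i)) (x (P , next i)) (x (Q , next i))

    LapW : ∀ j → Lap x (W , j) ≡ (x (W , j) - x (Q , j)) + (x (W , j) - x (Q , next j))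
    LapW j = trans (Lap-local x W j a (λ _ → 0ℚ) cells) (ℚP.+-identityʳ (a j))
      where
      a : Fin n → ℚ
      a i = (x (W , i) - x (Q , i)) + (x (W , i) - x (Q , next i))
      cells : ∀ i → Σℚ (cell i) (edgeTerm x (W , j)) ≡ δ (W , j) (W , i) * a i + δ (W , j) (W , next i) * 0ℚ
      cells i = solve 8 (λ d d′ p q u w p′ q′ →
          (con 0ℚ :* (p :- q) :+ con 0ℚ :* (q :- p)) :+ ((con 0ℚ :* (p :- u) :+ con 0ℚ :* (u :- p)) :+ ((con 0ℚ :* (u :- p′) :+ con 0ℚ :* (p′ :- u))
          :+ ((con 0ℚ :* (q :- w) :+ d :* (w :- q)) :+ ((d :* (w :- q′) :+ con 0ℚ :* (q′ :- w)) :+ con 0ℚ))))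
          := d :* ((w :- q) :+ (w :- q′)) :+ d′ :* con 0ℚ)
        refl (δ (W , j) (W , i)) (δ (W , j) (W , next i)) (x (P , i)) (x (Q , i)) (x (U , i)) (x (W , i)) (x (P , next i)) (x (Q , next i))

  swap : Vtx n → Vtx n
  swap (P , j) = (Q , j)
  swap (Q , j) = (P , j)
  swap (U , j) = (W , j)
  swap (W , j) = (U , j)

  Lap-swap : ∀ x w → Lap (x ∘ swap) w ≡ Lap x (swap w)
  Lap-swap x (P , j) = trans (LapP (x ∘ swap) j) (sym (LapQ x j))
  Lap-swap x (Q , j) = trans (LapQ (x ∘ swap) j) (sym (LapP x j))
  Lap-swap x (U , j) = trans (LapU (x ∘ swap) j) (sym (LapW x j))
  Lap-swap x (W , j) = trans (LapW (x ∘ swap) j) (sym (LapU x j))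

  ΣV : ∀ (f : Vtx n → ℚ) → Σℚ (RVertices n) f
       ≡ sumFin n (f ∘ (P ,_)) + (sumFin n (f ∘ (Q ,_)) + (sumFin n (f ∘ (U ,_)) + sumFin n (f ∘ (W ,_))))
  ΣV f = trans (Σℚ-concatMap (λ κ → map (κ ,_) (allFin n)) (P ∷ Q ∷ U ∷ W ∷ []) f)
    (cong₂ _+_ (row P) (cong₂ _+_ (row Q) (cong₂ _+_ (row U) (trans (cong (_+ 0ℚ) (row W)) (ℚP.+-identityʳ _)))))
    where
    row : ∀ κ → Σℚ (map (κ ,_) (allFin n)) f ≡ sumFin n (f ∘ (κ ,_))
    row κ = trans (Σℚ-map (κ ,_) (allFin n) f) (Σℚ-allFin n (f ∘ (κ ,_)))

  length-RVertices : length (RVertices n) ≡ 4 ℕ.* n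
  length-RVertices =
    trans (ListP.length-++ (row P)) (cong₂ ℕ._+_ (ℓ P)
    (trans (ListP.length-++ (row Q)) (cong₂ ℕ._+_ (ℓ Q)
    (trans (ListP.length-++ (row U)) (cong₂ ℕ._+_ (ℓ U)
    (trans (ListP.length-++ (row W)) (cong₂ ℕ._+_ (ℓ W) refl)))))))
    where
    row : Kind → List (Vtx n)
    row κ = map (κ ,_) (allFin n)
    ℓ : ∀ κ → length (row κ) ≡ n
    ℓ κ = trans (ListP.length-map (κ ,_) (allFin n)) (ListP.length-tabulate id)

  sift-own : ∀ κ i (f : Vtx n → ℚ) → sumFin n (λ j → δ (κ , j) (κ , i) * f (κ , j)) ≡ f (κ , i)
  sift-own κ i f = sumFin-sift n (λ j → δ (κ , j) (κ , i)) (f ∘ (κ ,_)) i (δ-refl (κ , i))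
                     (λ j j≢i → δ-≢ (κ , j) (κ , i) (λ eq → j≢i (cong proj₂ eq)))

  sift : ∀ a (f : Vtx n → ℚ) → Σℚ (RVertices n) (λ w → δ w a * f w) ≡ f a
  sift (P , i) f = trans (ΣV (λ w → δ w (P , i) * f w))
    (trans (cong₂ _+_ (sift-own P i f) (cong₂ _+_ (sumFin-0* n (f ∘ (Q ,_))) (cong₂ _+_ (sumFin-0* n (f ∘ (U ,_))) (sumFin-0* n (f ∘ (W ,_))))))
           (ℚP.+-identityʳ (f (P , i))))
  sift (Q , i) f = trans (ΣV (λ w → δ w (Q , i) * f w))
    (trans (cong₂ _+_ (sumFin-0* n (f ∘ (P ,_))) (cong₂ _+_ (sift-own Q i f) (cong₂ _+_ (sumFin-0* n (f ∘ (U ,_))) (sumFin-0* n (f ∘ (W ,_))))))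
           (trans (ℚP.+-identityˡ _) (ℚP.+-identityʳ (f (Q , i)))))
  sift (U , i) f = trans (ΣV (λ w → δ w (U , i) * f w))
    (trans (cong₂ _+_ (sumFin-0* n (f ∘ (P ,_))) (cong₂ _+_ (sumFin-0* n (f ∘ (Q ,_))) (cong₂ _+_ (sift-own U i f) (sumFin-0* n (f ∘ (W ,_))))))
           (trans (ℚP.+-identityˡ _) (trans (ℚP.+-identityˡ _) (ℚP.+-identityʳ (f (U , i))))))
  sift (W , i) f = trans (ΣV (λ w → δ w (W , i) * f w))
    (trans (cong₂ _+_ (sumFin-0* n (f ∘ (P ,_))) (cong₂ _+_ (sumFin-0* n (f ∘ (Q ,_))) (cong₂ _+_ (sumFin-0* n (f ∘ (U ,_))) (sift-own W i f))))
           (trans (ℚP.+-identityˡ _) (trans (ℚP.+-identityˡ _) (ℚP.+-identityˡ (f (W , i))))))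

  connected : Connected
  connected z harmonic a b = trans (to-origin a) (sym (to-origin b))
    where
    cell-edges : ∀ i → All (λ e → z (proj₁ e) ≡ z (proj₂ e)) (cell i)
    cell-edges = AllP.tabulate⁻ {f = id} (AllP.map⁻ {xs = allFin n} {f = cell}
                   (AllP.concat⁻ {xss = map cell (allFin n)} (harmonic⇒edgewise-constant sift z harmonic)))
    PQ : ∀ i → z (P , i) ≡ z (Q , i)
    PQ i = All.head (cell-edges i)
    PU : ∀ i → z (P , i) ≡ z (U , i)
    PU i = All.head (All.tail (cell-edges i))
    UP : ∀ i → z (U , i) ≡ z (P , next i)
    UP i = All.head (All.tail (All.tail (cell-edges i)))
    QW : ∀ i → z (Q , i) ≡ z (W , i)
    QW i = All.head (All.tail (All.tail (All.tail (cell-edges i))))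
    P-origin : ∀ i → z (P , i) ≡ z (P , zero)
    P-origin = next-induction (λ i → z (P , i) ≡ z (P , zero)) refl
                 (λ i ih → trans (sym (trans (PU i) (UP i))) ih)
    to-origin : ∀ w → z w ≡ z (P , zero)
    to-origin (P , i) = P-origin i
    to-origin (Q , i) = trans (sym (PQ i)) (P-origin i)
    to-origin (U , i) = trans (sym (PU i)) (P-origin i)
    to-origin (W , i) = trans (sym (trans (PQ i) (QW i))) (P-origin i)

-- Green potentials of Rₙ

module Green (k : ℕ) where

  private
    n : ℕ
    n = suc k

  open Cyclic k
  open Chain k
  open R n

  -- Ring-solver images of the definitions below, a and b standing for A and B, and n = 1 + K.
  private
    G̲ : ∀ {m} → Polynomial m → Polynomial m → Polynomial m → Polynomial m
    G̲ a N t = a :* (t :* t :- lit 2 :* N :* t)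
    φ̲ χ̲ : ∀ {m} → Polynomial m → Polynomial m → Polynomial m → Polynomial m → Polynomial m → Polynomial m
    φ̲ a N D s e = G̲ a N (lit 2 :* D) :+ s :* e
    χ̲ a N D s e = G̲ a N (lit 2 :* D) :+ s :* (lit 2 :* e)
    ψ̲ : ∀ {m} → Polynomial m → Polynomial m → Polynomial m → Polynomial m → Polynomial m → Polynomial m → Polynomial m
    ψ̲ a N D s e e′ = G̲ a N (lit 2 :* D :+ con 1ℚ) :+ s :* (con ½ :* (e :+ e′))
    cellGreen̲ : ∀ {m} → Polynomial m → Polynomial m → Polynomial m → Polynomial m
    cellGreen̲ a N D = G̲ a N (lit 2 :* D) :+ G̲ a N (lit 2 :* D :+ con 1ℚ)
    cubic̲ : ∀ {m} → Polynomial m → Polynomial m → Polynomial m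
    cubic̲ N M = M :* (lit 2 :* M :- con 1ℚ) :* (lit 4 :* M :- con 1ℚ) :- lit 6 :* N :* M :* (lit 2 :* M :- con 1ℚ)
    E₀̲ E₁̲ Eₖ̲ : ∀ {m} → Polynomial m → Polynomial m → Polynomial m
    E₀̲ b un = b :* (con (u 0) :+ un)
    E₁̲ b uk = b :* (con (u 1) :+ uk)
    Eₖ̲ b uk = b :* (uk :+ con (u 1))
    source-certificate : ∀ {m} → Polynomial m → Polynomial m → Polynomial m → Polynomial m →
                                  Polynomial m → Polynomial m → Polynomial m → Polynomial m
    source-certificate a b K s uk un vn =
      (((con ½ :* (con 1ℚ :+ s) :- lit 2 :* a) :+ con ½ :* (a :* (lit 8 :* (con 1ℚ :+ K)) :- con 1ℚ))
        :+ (con ½ :* s) :* (b :* (lit 16 :* vn) :- con 1ℚ)) :+ (s :* b) :* ((lit 3 :* un :- uk) :- lit 8 :* vn)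

  N K : ℚ
  N = toℚ n
  K = toℚ k

  A : ℚ
  A = 1/_ (ℕtoℚ (8 ℕ.* n)) {{ℕtoℚ-nonZero (8 ℕ.* n)}}

  B : ℚ
  B = 1/_ (ℕtoℚ (16 ℕ.* vℕ n)) {{ℕtoℚ-nonZero (16 ℕ.* vℕ n) {{ℕP.m*n≢0 16 (vℕ n) {{_}} {{vℕ-suc-nonZero k}}}}}}

  A-inverse : A * (ℕtoℚ 8 * N) ≡ 1ℚ
  A-inverse = trans (cong (A *_) (sym (trans (ℕtoℚ≡toℚ (8 ℕ.* n)) (toℚ-* 8 n))))
                    (ℚP.*-inverseˡ (ℕtoℚ (8 ℕ.* n)) {{ℕtoℚ-nonZero (8 ℕ.* n)}})

  B-inverse : B * (ℕtoℚ 16 * v n) ≡ 1ℚ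
  B-inverse = trans (cong (B *_) (sym (trans (ℕtoℚ≡toℚ (16 ℕ.* vℕ n)) (toℚ-* 16 (vℕ n)))))
                    (ℚP.*-inverseˡ (ℕtoℚ (16 ℕ.* vℕ n)) {{ℕtoℚ-nonZero (16 ℕ.* vℕ n) {{ℕP.m*n≢0 16 (vℕ n) {{_}} {{vℕ-suc-nonZero k}}}}}})

  -- Current drained at each vertex: 1 / |V| = 1 / (4n).
  c : ℚ
  c = ℕtoℚ 2 * A

  -- Potential of the 2n-cycle P₀ U₀ P₁ U₁ … at position t from the source.
  cycleGreen : ℚ → ℚ
  cycleGreen t = A * (t * t - ℕtoℚ 2 * N * t)

  E : ℕ → ℚ
  E d = B * (u d + u (n ∸ d))

  E-rec : ∀ e → suc e < n → E e + E (suc (suc e)) ≡ ℕtoℚ 6 * E (suc e)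
  E-rec e e+1<n = begin
    B * (u e + u (n ∸ e)) + B * (u (suc (suc e)) + u r)
      ≡⟨ cong (λ t → B * (u e + u t) + B * (u (suc (suc e)) + u r)) n∸e ⟩
    B * (u e + u (suc (suc r))) + B * (u (suc (suc e)) + u r)
      ≡⟨ solve 5 (λ b a₀ a₂ c₀ c₂ → b :* (a₀ :+ c₂) :+ b :* (a₂ :+ c₀) := b :* ((a₀ :+ a₂) :+ (c₀ :+ c₂)))
                 refl B (u e) (u (suc (suc e))) (u r) (u (suc (suc r))) ⟩
    B * ((u e + u (suc (suc e))) + (u r + u (suc (suc r))))
      ≡⟨ cong₂ (λ x y → B * (x + y)) (u-rec e) (u-rec r) ⟩
    B * (ℕtoℚ 6 * u (suc e) + ℕtoℚ 6 * u (suc r))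
      ≡⟨ solve 3 (λ b x y → b :* (lit 6 :* x :+ lit 6 :* y) := lit 6 :* (b :* (x :+ y))) refl B (u (suc e)) (u (suc r)) ⟩
    ℕtoℚ 6 * (B * (u (suc e) + u (suc r)))
      ≡⟨ cong (λ t → ℕtoℚ 6 * (B * (u (suc e) + u t))) (sym (ℕP.+-∸-assoc 1 e+1<n)) ⟩
    ℕtoℚ 6 * (B * (u (suc e) + u (n ∸ suc e)))  ∎
    where
    open ≡-Reasoning
    r : ℕ
    r = n ∸ suc (suc e)
    n∸e : n ∸ e ≡ suc (suc r)
    n∸e = trans (ℕP.+-∸-assoc 1 (ℕP.<⇒≤ (ℕP.≤-pred e+1<n))) (cong suc (ℕP.+-∸-assoc 1 (ℕP.≤-pred e+1<n)))

  E-last : E k ≡ B * (u k + u 1)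
  E-last = cong (λ t → B * (u k + u t)) (ℕP.m+n∸n≡m 1 k)

  E-wrap : E n ≡ E 0
  E-wrap = trans (cong (λ t → B * (u n + u t)) (ℕP.n∸n≡0 n)) (cong (B *_) (ℚP.+-comm (u n) (u 0)))

  -- Values at distance d of the potential of a source on the P row (φ on the P/Q rows, ψ on the
  -- U/W rows) and of a source on the U row (χ on the U/W rows, ψ shifted by one on the P/Q rows).
  -- The sign σ = ±1 selects the row of the source: the antisymmetric part changes sign across rows.
  φ ψ χ : ℚ → ℕ → ℚ
  φ σ d = cycleGreen (ℕtoℚ 2 * toℚ d) + σ * E d
  ψ σ d = cycleGreen (ℕtoℚ 2 * toℚ d + 1ℚ) + σ * (½ * (E d + E (suc d)))
  χ σ d = cycleGreen (ℕtoℚ 2 * toℚ d) + σ * (ℕtoℚ 2 * E d)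

  cycleGreen-wrap : cycleGreen (ℕtoℚ 2 * N) ≡ cycleGreen (ℕtoℚ 2 * 0ℚ)
  cycleGreen-wrap = solve 2 (λ a N → G̲ a N (lit 2 :* N) := G̲ a N (lit 2 :* con 0ℚ)) refl A N

  φ-wrap : ∀ σ → φ σ n ≡ φ σ 0
  φ-wrap σ = cong₂ (λ g e → g + σ * e) cycleGreen-wrap E-wrap

  ΔPP : ℚ → ℕ → ℕ → ℚ
  ΔPP σ d e = ((φ σ d - φ (- σ) d) + (φ σ d - ψ σ d)) + (φ σ d - ψ σ e)

  ΔPU : ℚ → ℕ → ℕ → ℚ
  ΔPU σ d d′ = (ψ σ d - φ σ d) + (ψ σ d - φ σ d′)

  ΔUU : ℚ → ℕ → ℕ → ℕ → ℚ
  ΔUU σ d f f′ = (χ σ d - ψ σ f) + (χ σ d - ψ σ f′)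

  ΔUP : ℚ → ℕ → ℕ → ℕ → ℚ
  ΔUP σ f d d′ = ((ψ σ f - ψ (- σ) f) + (ψ σ f - χ σ d)) + (ψ σ f - χ σ d′)

  ΔPP-interior : ∀ σ e → suc e < n → ΔPP σ (suc e) e ≡ 0ℚ - c
  ΔPP-interior σ e e+1<n = ≡-modulo {w = - ½ * σ} {x = E e + E (suc (suc e))} {y = ℕtoℚ 6 * E (suc e)}
    (solve 7 (λ a N D s e₀ e₁ e₂ →
        ((φ̲ a N (con 1ℚ :+ D) s e₁ :- φ̲ a N (con 1ℚ :+ D) (:- s) e₁) :+ (φ̲ a N (con 1ℚ :+ D) s e₁ :- ψ̲ a N (con 1ℚ :+ D) s e₁ e₂))
          :+ (φ̲ a N (con 1ℚ :+ D) s e₁ :- ψ̲ a N D s e₀ e₁)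
        := (con 0ℚ :- lit 2 :* a) :+ (con (- ½) :* s) :* ((e₀ :+ e₂) :- lit 6 :* e₁))
      refl A N (toℚ e) σ (E e) (E (suc e)) (E (suc (suc e))))
    (E-rec e e+1<n)

  ΔPU-interior : ∀ σ d → ΔPU σ d (suc d) ≡ 0ℚ - c
  ΔPU-interior σ d = solve 6 (λ a N D s e₀ e₁ →
      (ψ̲ a N D s e₀ e₁ :- φ̲ a N D s e₀) :+ (ψ̲ a N D s e₀ e₁ :- φ̲ a N (con 1ℚ :+ D) s e₁)
      := con 0ℚ :- lit 2 :* a)
    refl A N (toℚ d) σ (E d) (E (suc d))

  ΔUU-interior : ∀ σ f → suc f < n → ΔUU σ (suc f) f (suc f) ≡ 0ℚ - c
  ΔUU-interior σ f f+1<n = ≡-modulo {w = - ½ * σ} {x = E f + E (suc (suc f))} {y = ℕtoℚ 6 * E (suc f)}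
    (solve 7 (λ a N D s e₀ e₁ e₂ →
        (χ̲ a N (con 1ℚ :+ D) s e₁ :- ψ̲ a N D s e₀ e₁) :+ (χ̲ a N (con 1ℚ :+ D) s e₁ :- ψ̲ a N (con 1ℚ :+ D) s e₁ e₂)
        := (con 0ℚ :- lit 2 :* a) :+ (con (- ½) :* s) :* ((e₀ :+ e₂) :- lit 6 :* e₁))
      refl A N (toℚ f) σ (E f) (E (suc f)) (E (suc (suc f))))
    (E-rec f f+1<n)

  ΔUP-interior : ∀ σ f → ΔUP σ f (suc f) f ≡ 0ℚ - c
  ΔUP-interior σ f = solve 6 (λ a N D s e₀ e₁ →
      ((ψ̲ a N D s e₀ e₁ :- ψ̲ a N D (:- s) e₀ e₁) :+ (ψ̲ a N D s e₀ e₁ :- χ̲ a N (con 1ℚ :+ D) s e₁))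
        :+ (ψ̲ a N D s e₀ e₁ :- χ̲ a N D s e₀)
      := con 0ℚ :- lit 2 :* a)
    refl A N (toℚ f) σ (E f) (E (suc f))

  ψ-last : ∀ σ → ψ σ k ≡ cycleGreen (ℕtoℚ 2 * K + 1ℚ) + σ * (½ * (B * (u k + u 1) + B * (u 0 + u n)))
  ψ-last σ = cong (λ m → cycleGreen (ℕtoℚ 2 * K + 1ℚ) + σ * (½ * m)) (cong₂ _+_ E-last E-wrap)

  -- The source identities hold only modulo A · 8N = 1, B · 16vₙ = 1 and 3uₙ − uₖ = 8vₙ.
  source-balance : ∀ {σ lhs} →
    lhs ≡ ((½ * (1ℚ + σ) - c + ½ * (A * (ℕtoℚ 8 * N) - 1ℚ)) + ½ * σ * (B * (ℕtoℚ 16 * v n) - 1ℚ))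
          + σ * B * ((ℕtoℚ 3 * u n - u k) - ℕtoℚ 8 * v n) →
    lhs ≡ ½ * (1ℚ + σ) - c
  source-balance {σ} eq =
    ≡-modulo {w = ½} {x = A * (ℕtoℚ 8 * N)} {y = 1ℚ}
      (≡-modulo {w = ½ * σ} {x = B * (ℕtoℚ 16 * v n)} {y = 1ℚ}
        (≡-modulo {w = σ * B} {x = ℕtoℚ 3 * u n - u k} {y = ℕtoℚ 8 * v n} eq (u-pred k))
        B-inverse)
      A-inverse

  -- At the source half of the unit current feeds the symmetric part and half the antisymmetric one.
  ΔPP-source : ∀ σ → ΔPP σ 0 k ≡ ½ * (1ℚ + σ) - c
  ΔPP-source σ = begin
    ΔPP σ 0 k                                                  ≡⟨ cong (λ t → ((φ σ 0 - φ (- σ) 0) + (φ σ 0 - ψ σ 0)) + (φ σ 0 - t)) (ψ-last σ) ⟩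
    ((φ σ 0 - φ (- σ) 0) + (φ σ 0 - ψ σ 0)) + (φ σ 0 - ψ-end)  ≡⟨ source-balance {σ}
      (solve 7 (λ a b K s uk un vn →
          ((φ̲ a (con 1ℚ :+ K) (con 0ℚ) s (E₀̲ b un) :- φ̲ a (con 1ℚ :+ K) (con 0ℚ) (:- s) (E₀̲ b un))
            :+ (φ̲ a (con 1ℚ :+ K) (con 0ℚ) s (E₀̲ b un) :- ψ̲ a (con 1ℚ :+ K) (con 0ℚ) s (E₀̲ b un) (E₁̲ b uk)))
            :+ (φ̲ a (con 1ℚ :+ K) (con 0ℚ) s (E₀̲ b un) :- ψ̲ a (con 1ℚ :+ K) K s (Eₖ̲ b uk) (E₀̲ b un))
          := source-certificate a b K s uk un vn)
        refl A B K σ (u k) (u n) (v n)) ⟩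
    ½ * (1ℚ + σ) - c                                           ∎
    where
    open ≡-Reasoning
    ψ-end : ℚ
    ψ-end = cycleGreen (ℕtoℚ 2 * K + 1ℚ) + σ * (½ * (B * (u k + u 1) + B * (u 0 + u n)))

  ΔUU-source : ∀ σ → ΔUU σ 0 k 0 ≡ ½ * (1ℚ + σ) - c
  ΔUU-source σ = begin
    ΔUU σ 0 k 0                                   ≡⟨ cong (λ t → (χ σ 0 - t) + (χ σ 0 - ψ σ 0)) (ψ-last σ) ⟩
    (χ σ 0 - ψ-end) + (χ σ 0 - ψ σ 0)             ≡⟨ source-balance {σ}
      (solve 7 (λ a b K s uk un vn →
          (χ̲ a (con 1ℚ :+ K) (con 0ℚ) s (E₀̲ b un) :- ψ̲ a (con 1ℚ :+ K) K s (Eₖ̲ b uk) (E₀̲ b un))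
            :+ (χ̲ a (con 1ℚ :+ K) (con 0ℚ) s (E₀̲ b un) :- ψ̲ a (con 1ℚ :+ K) (con 0ℚ) s (E₀̲ b un) (E₁̲ b uk))
          := source-certificate a b K s uk un vn)
        refl A B K σ (u k) (u n) (v n)) ⟩
    ½ * (1ℚ + σ) - c                              ∎
    where
    open ≡-Reasoning
    ψ-end : ℚ
    ψ-end = cycleGreen (ℕtoℚ 2 * K + 1ℚ) + σ * (½ * (B * (u k + u 1) + B * (u 0 + u n)))

  χ-wrap : ∀ σ → χ σ n ≡ χ σ 0
  χ-wrap σ = cong₂ (λ g e → g + σ * (ℕtoℚ 2 * e)) cycleGreen-wrap E-wrap

  greenP greenU : ℚ → Fin n → Vtx n → ℚ
  greenP σ i (P , j) = φ σ (dist i j)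
  greenP σ i (Q , j) = φ (- σ) (dist i j)
  greenP σ i (U , j) = ψ σ (dist i j)
  greenP σ i (W , j) = ψ (- σ) (dist i j)
  greenU σ i (P , j) = ψ σ (dist (next i) j)
  greenU σ i (Q , j) = ψ (- σ) (dist (next i) j)
  greenU σ i (U , j) = χ σ (dist i j)
  greenU σ i (W , j) = χ (- σ) (dist i j)

  δ-dist-suc : ∀ κ i j d → dist i j ≡ suc d → δ (κ , i) (κ , j) ≡ 0ℚ
  δ-dist-suc κ i j d eq = δ-≢ (κ , i) (κ , j) (λ i≡j → ℕP.0≢1+n (trans (sym (dist-refl i)) (trans (cong (dist i ∘ proj₂) i≡j) eq)))

  δ-dist-zero : ∀ κ i j → dist i j ≡ 0 → δ (κ , i) (κ , j) ≡ 1ℚ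
  δ-dist-zero κ i j eq = subst (λ t → δ (κ , i) (κ , t) ≡ 1ℚ) (dist≡0⇒≡ i j eq) (δ-refl (κ , i))

  inject-source : ∀ σ {x} → x ≡ 1ℚ → ½ * (1ℚ + σ) - c ≡ ½ * (1ℚ + σ) * x - c
  inject-source σ x≡1 = cong (_- c) (sym (trans (cong (½ * (1ℚ + σ) *_) x≡1) (ℚP.*-identityʳ (½ * (1ℚ + σ)))))

  inject-elsewhere : ∀ σ {x} → x ≡ 0ℚ → 0ℚ - c ≡ ½ * (1ℚ + σ) * x - c
  inject-elsewhere σ x≡0 = cong (_- c) (sym (trans (cong (½ * (1ℚ + σ) *_) x≡0) (ℚP.*-zeroʳ (½ * (1ℚ + σ)))))

  Lap-greenP-P : ∀ σ i j → Lap (greenP σ i) (P , j) ≡ ½ * (1ℚ + σ) * δ (P , i) (P , j) - c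
  Lap-greenP-P σ i j = trans (LapP (greenP σ i) j)
    (trans (cong (λ d → ΔPP σ d e) (dist-prevʳ i j)) (by-cases (sucMod-cases e (dist<n i (prev j)))))
    where
    e : ℕ
    e = dist i (prev j)
    by-cases : (sucMod e ≡ suc e × suc e < n) ⊎ (sucMod e ≡ 0 × e ≡ k) →
               ΔPP σ (sucMod e) e ≡ ½ * (1ℚ + σ) * δ (P , i) (P , j) - c
    by-cases (inj₁ (eq , e+1<n)) = trans (cong (λ d → ΔPP σ d e) eq)
      (trans (ΔPP-interior σ e e+1<n) (inject-elsewhere σ (δ-dist-suc P i j e (trans (dist-prevʳ i j) eq))))
    by-cases (inj₂ (eq , e≡k)) = trans (cong₂ (ΔPP σ) eq e≡k)
      (trans (ΔPP-source σ) (inject-source σ (δ-dist-zero P i j (trans (dist-prevʳ i j) eq))))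

  Lap-greenP-U : ∀ σ i j → Lap (greenP σ i) (U , j) ≡ 0ℚ - c
  Lap-greenP-U σ i j = trans (LapU (greenP σ i) j)
    (trans (cong (ΔPU σ d) (dist-nextʳ i j)) (by-cases (sucMod-cases d (dist<n i j))))
    where
    d : ℕ
    d = dist i j
    by-cases : (sucMod d ≡ suc d × suc d < n) ⊎ (sucMod d ≡ 0 × d ≡ k) → ΔPU σ d (sucMod d) ≡ 0ℚ - c
    by-cases (inj₁ (eq , _))   = trans (cong (ΔPU σ d) eq) (ΔPU-interior σ d)
    by-cases (inj₂ (eq , d≡k)) = trans (cong (λ t → (ψ σ d - φ σ d) + (ψ σ d - t)) wrap) (ΔPU-interior σ d)
      where
      wrap : φ σ (sucMod d) ≡ φ σ (suc d)
      wrap = trans (cong (φ σ) eq) (trans (sym (φ-wrap σ)) (cong (φ σ ∘ suc) (sym d≡k)))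

  Lap-greenU-U : ∀ σ i j → Lap (greenU σ i) (U , j) ≡ ½ * (1ℚ + σ) * δ (U , i) (U , j) - c
  Lap-greenU-U σ i j = trans (LapU (greenU σ i) j)
    (trans (cong₂ (λ d f′ → ΔUU σ d f f′) (dist-nextˡ i j) (dist-nextʳ (next i) j)) (by-cases (sucMod-cases f (dist<n (next i) j))))
    where
    f : ℕ
    f = dist (next i) j
    by-cases : (sucMod f ≡ suc f × suc f < n) ⊎ (sucMod f ≡ 0 × f ≡ k) →
               ΔUU σ (sucMod f) f (sucMod f) ≡ ½ * (1ℚ + σ) * δ (U , i) (U , j) - c
    by-cases (inj₁ (eq , f+1<n)) = trans (cong (λ d → ΔUU σ d f d) eq)
      (trans (ΔUU-interior σ f f+1<n) (inject-elsewhere σ (δ-dist-suc U i j f (trans (dist-nextˡ i j) eq))))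
    by-cases (inj₂ (eq , f≡k)) = trans (cong₂ (λ d f → ΔUU σ d f d) eq f≡k)
      (trans (ΔUU-source σ) (inject-source σ (δ-dist-zero U i j (trans (dist-nextˡ i j) eq))))

  Lap-greenU-P : ∀ σ i j → Lap (greenU σ i) (P , j) ≡ 0ℚ - c
  Lap-greenU-P σ i j = trans (LapP (greenU σ i) j)
    (trans (cong₂ (ΔUP σ f) (dist-nextˡ i j) (dist-prev-next i j)) (by-cases (sucMod-cases f (dist<n (next i) j))))
    where
    f : ℕ
    f = dist (next i) j
    by-cases : (sucMod f ≡ suc f × suc f < n) ⊎ (sucMod f ≡ 0 × f ≡ k) → ΔUP σ f (sucMod f) f ≡ 0ℚ - c
    by-cases (inj₁ (eq , _))   = trans (cong (λ d → ΔUP σ f d f) eq) (ΔUP-interior σ f)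
    by-cases (inj₂ (eq , f≡k)) = trans (cong (λ t → ((ψ σ f - ψ (- σ) f) + (ψ σ f - t)) + (ψ σ f - χ σ f)) wrap) (ΔUP-interior σ f)
      where
      wrap : χ σ (sucMod f) ≡ χ σ (suc f)
      wrap = trans (cong (χ σ) eq) (trans (sym (χ-wrap σ)) (cong (χ σ ∘ suc) (sym f≡k)))

  neg-neg : ∀ σ → σ ≡ - - σ
  neg-neg σ = solve 1 (λ s → s := :- :- s) refl σ

  greenP-swap : ∀ σ i w → greenP σ i (swap w) ≡ greenP (- σ) i w
  greenP-swap σ i (P , j) = refl
  greenP-swap σ i (Q , j) = cong (λ s → φ s (dist i j)) (neg-neg σ)
  greenP-swap σ i (U , j) = refl
  greenP-swap σ i (W , j) = cong (λ s → ψ s (dist i j)) (neg-neg σ)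

  greenU-swap : ∀ σ i w → greenU σ i (swap w) ≡ greenU (- σ) i w
  greenU-swap σ i (P , j) = refl
  greenU-swap σ i (Q , j) = cong (λ s → ψ s (dist (next i) j)) (neg-neg σ)
  greenU-swap σ i (U , j) = refl
  greenU-swap σ i (W , j) = cong (λ s → χ s (dist i j)) (neg-neg σ)

  Lap-greenP-swap : ∀ σ i w → Lap (greenP σ i) (swap w) ≡ Lap (greenP (- σ) i) w
  Lap-greenP-swap σ i w = trans (sym (Lap-swap (greenP σ i) w)) (Lap-cong (greenP-swap σ i) w)

  Lap-greenU-swap : ∀ σ i w → Lap (greenU σ i) (swap w) ≡ Lap (greenU (- σ) i) w
  Lap-greenU-swap σ i w = trans (sym (Lap-swap (greenU σ i) w)) (Lap-cong (greenU-swap σ i) w)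

  weights-left : ∀ σ x → ½ * (1ℚ + σ) * x - c ≡ ½ * (1ℚ + σ) * x + ½ * (1ℚ - σ) * 0ℚ - c
  weights-left σ x = solve 3 (λ s x c → con ½ :* (con 1ℚ :+ s) :* x :- c
                                         := con ½ :* (con 1ℚ :+ s) :* x :+ con ½ :* (con 1ℚ :- s) :* con 0ℚ :- c) refl σ x c

  weights-right : ∀ σ x → ½ * (1ℚ + - σ) * x - c ≡ ½ * (1ℚ + σ) * 0ℚ + ½ * (1ℚ - σ) * x - c
  weights-right σ x = solve 3 (λ s x c → con ½ :* (con 1ℚ :+ :- s) :* x :- c
                                          := con ½ :* (con 1ℚ :+ s) :* con 0ℚ :+ con ½ :* (con 1ℚ :- s) :* x :- c) refl σ x c

  weights-none : ∀ σ → 0ℚ - c ≡ ½ * (1ℚ + σ) * 0ℚ + ½ * (1ℚ - σ) * 0ℚ - c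
  weights-none σ = solve 2 (λ s c → con 0ℚ :- c := con ½ :* (con 1ℚ :+ s) :* con 0ℚ :+ con ½ :* (con 1ℚ :- s) :* con 0ℚ :- c) refl σ c

  Lap-greenP : ∀ σ i w → Lap (greenP σ i) w ≡ ½ * (1ℚ + σ) * δ (P , i) w + ½ * (1ℚ - σ) * δ (Q , i) w - c
  Lap-greenP σ i (P , j) = trans (Lap-greenP-P σ i j) (weights-left σ (δ (P , i) (P , j)))
  Lap-greenP σ i (Q , j) = trans (Lap-greenP-swap σ i (P , j)) (trans (Lap-greenP-P (- σ) i j)
                             (trans (cong (λ t → ½ * (1ℚ + - σ) * t - c) (δ-kind P Q i j)) (weights-right σ (δ (Q , i) (Q , j)))))
  Lap-greenP σ i (U , j) = trans (Lap-greenP-U σ i j) (weights-none σ)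
  Lap-greenP σ i (W , j) = trans (Lap-greenP-swap σ i (U , j)) (trans (Lap-greenP-U (- σ) i j) (weights-none σ))

  Lap-greenU : ∀ σ i w → Lap (greenU σ i) w ≡ ½ * (1ℚ + σ) * δ (U , i) w + ½ * (1ℚ - σ) * δ (W , i) w - c
  Lap-greenU σ i (P , j) = trans (Lap-greenU-P σ i j) (weights-none σ)
  Lap-greenU σ i (Q , j) = trans (Lap-greenU-swap σ i (P , j)) (trans (Lap-greenU-P (- σ) i j) (weights-none σ))
  Lap-greenU σ i (U , j) = trans (Lap-greenU-U σ i j) (weights-left σ (δ (U , i) (U , j)))
  Lap-greenU σ i (W , j) = trans (Lap-greenU-swap σ i (U , j)) (trans (Lap-greenU-U (- σ) i j)
                             (trans (cong (λ t → ½ * (1ℚ + - σ) * t - c) (δ-kind U W i j)) (weights-right σ (δ (W , i) (W , j)))))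

  green : Vtx n → Vtx n → ℚ
  green (P , i) = greenP 1ℚ i
  green (Q , i) = greenP (- 1ℚ) i
  green (U , i) = greenU 1ℚ i
  green (W , i) = greenU (- 1ℚ) i

  upper : ∀ x y → ½ * (1ℚ + 1ℚ) * x + ½ * (1ℚ - 1ℚ) * y - c ≡ x - c
  upper x y = solve 3 (λ x y c → con ½ :* (con 1ℚ :+ con 1ℚ) :* x :+ con ½ :* (con 1ℚ :- con 1ℚ) :* y :- c := x :- c) refl x y c

  lower : ∀ x y → ½ * (1ℚ + - 1ℚ) * x + ½ * (1ℚ - - 1ℚ) * y - c ≡ y - c
  lower x y = solve 3 (λ x y c → con ½ :* (con 1ℚ :+ :- con 1ℚ) :* x :+ con ½ :* (con 1ℚ :- :- con 1ℚ) :* y :- c := y :- c) refl x y c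

  Lap-green : ∀ s w → Lap (green s) w ≡ δ s w - c
  Lap-green (P , i) w = trans (Lap-greenP 1ℚ i w) (upper (δ (P , i) w) (δ (Q , i) w))
  Lap-green (Q , i) w = trans (Lap-greenP (- 1ℚ) i w) (lower (δ (P , i) w) (δ (Q , i) w))
  Lap-green (U , i) w = trans (Lap-greenU 1ℚ i w) (upper (δ (U , i) w) (δ (W , i) w))
  Lap-green (W , i) w = trans (Lap-greenU (- 1ℚ) i w) (lower (δ (U , i) w) (δ (W , i) w))

  isResistanceFn : IsResistanceFn (greenRes green)
  isResistanceFn = greenRes-isResistanceFn green c Lap-green

  cellGreen : ℕ → ℚ
  cellGreen d = cycleGreen (ℕtoℚ 2 * toℚ d) + cycleGreen (ℕtoℚ 2 * toℚ d + 1ℚ)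

  T : ℚ
  T = sumℕ n (λ d → ℕtoℚ 2 * cellGreen d)

  row-sum : ∀ (i₁ i₂ : Fin n) (f₁ f₂ f₃ f₄ : ℕ → ℚ) →
    (∀ d → f₁ d + (f₂ d + (f₃ d + f₄ d)) ≡ ℕtoℚ 2 * cellGreen d) →
    sumFin n (f₁ ∘ dist i₁) + (sumFin n (f₂ ∘ dist i₁) + (sumFin n (f₃ ∘ dist i₂) + sumFin n (f₄ ∘ dist i₂))) ≡ T
  row-sum i₁ i₂ f₁ f₂ f₃ f₄ total = begin
    sumFin n (f₁ ∘ dist i₁) + (sumFin n (f₂ ∘ dist i₁) + (sumFin n (f₃ ∘ dist i₂) + sumFin n (f₄ ∘ dist i₂)))
      ≡⟨ cong₂ _+_ (sumFin-dist i₁ f₁) (cong₂ _+_ (sumFin-dist i₁ f₂) (cong₂ _+_ (sumFin-dist i₂ f₃) (sumFin-dist i₂ f₄))) ⟩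
    sumℕ n f₁ + (sumℕ n f₂ + (sumℕ n f₃ + sumℕ n f₄))
      ≡⟨ cong (λ t → sumℕ n f₁ + (sumℕ n f₂ + t)) (sumℕ-+ n f₃ f₄) ⟨
    sumℕ n f₁ + (sumℕ n f₂ + sumℕ n (λ d → f₃ d + f₄ d))
      ≡⟨ cong (sumℕ n f₁ +_) (sumℕ-+ n f₂ (λ d → f₃ d + f₄ d)) ⟨
    sumℕ n f₁ + sumℕ n (λ d → f₂ d + (f₃ d + f₄ d))
      ≡⟨ sumℕ-+ n f₁ (λ d → f₂ d + (f₃ d + f₄ d)) ⟨
    sumℕ n (λ d → f₁ d + (f₂ d + (f₃ d + f₄ d)))
      ≡⟨ sumℕ-cong n total ⟩
    T ∎
    where open ≡-Reasoning

  φψ-total : ∀ σ d → φ σ d + (φ (- σ) d + (ψ σ d + ψ (- σ) d)) ≡ ℕtoℚ 2 * cellGreen d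
  φψ-total σ d = solve 6 (λ a N D s e₀ e₁ →
      φ̲ a N D s e₀ :+ (φ̲ a N D (:- s) e₀ :+ (ψ̲ a N D s e₀ e₁ :+ ψ̲ a N D (:- s) e₀ e₁))
      := lit 2 :* cellGreen̲ a N D)
    refl A N (toℚ d) σ (E d) (E (suc d))

  ψχ-total : ∀ σ d → ψ σ d + (ψ (- σ) d + (χ σ d + χ (- σ) d)) ≡ ℕtoℚ 2 * cellGreen d
  ψχ-total σ d = solve 6 (λ a N D s e₀ e₁ →
      ψ̲ a N D s e₀ e₁ :+ (ψ̲ a N D (:- s) e₀ e₁ :+ (χ̲ a N D s e₀ :+ χ̲ a N D (:- s) e₀))
      := lit 2 :* cellGreen̲ a N D)
    refl A N (toℚ d) σ (E d) (E (suc d))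

  green-rows : ∀ s → Σℚ (RVertices n) (green s) ≡ T
  green-rows (P , i) = trans (ΣV (greenP 1ℚ i)) (row-sum i i (φ 1ℚ) (φ (- 1ℚ)) (ψ 1ℚ) (ψ (- 1ℚ)) (φψ-total 1ℚ))
  green-rows (Q , i) = trans (ΣV (greenP (- 1ℚ) i)) (row-sum i i (φ (- 1ℚ)) (φ (- - 1ℚ)) (ψ (- 1ℚ)) (ψ (- - 1ℚ)) (φψ-total (- 1ℚ)))
  green-rows (U , i) = trans (ΣV (greenU 1ℚ i)) (row-sum (next i) i (ψ 1ℚ) (ψ (- 1ℚ)) (χ 1ℚ) (χ (- 1ℚ)) (ψχ-total 1ℚ))
  green-rows (W , i) = trans (ΣV (greenU (- 1ℚ) i)) (row-sum (next i) i (ψ (- 1ℚ)) (ψ (- - 1ℚ)) (χ (- 1ℚ)) (χ (- - 1ℚ)) (ψχ-total (- 1ℚ)))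

  green-diagonal : Σℚ (RVertices n) (λ a → green a a) ≡ N * (φ 1ℚ 0 + (φ 1ℚ 0 + (χ 1ℚ 0 + χ 1ℚ 0)))
  green-diagonal = begin
    Σℚ (RVertices n) (λ a → green a a)
      ≡⟨ ΣV (λ a → green a a) ⟩
    sumFin n (diag φ) + (sumFin n (diag φ) + (sumFin n (diag χ) + sumFin n (diag χ)))
      ≡⟨ cong₂ _+_ (on-diagonal (φ 1ℚ)) (cong₂ _+_ (on-diagonal (φ 1ℚ)) (cong₂ _+_ (on-diagonal (χ 1ℚ)) (on-diagonal (χ 1ℚ)))) ⟩
    N * φ 1ℚ 0 + (N * φ 1ℚ 0 + (N * χ 1ℚ 0 + N * χ 1ℚ 0))
      ≡⟨ solve 3 (λ N x y → N :* x :+ (N :* x :+ (N :* y :+ N :* y)) := N :* (x :+ (x :+ (y :+ y)))) refl N (φ 1ℚ 0) (χ 1ℚ 0) ⟩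
    N * (φ 1ℚ 0 + (φ 1ℚ 0 + (χ 1ℚ 0 + χ 1ℚ 0)))
      ∎
    where
    open ≡-Reasoning
    diag : (ℚ → ℕ → ℚ) → Fin n → ℚ
    diag f i = f 1ℚ (dist i i)
    on-diagonal : ∀ f → sumFin n (λ i → f (dist i i)) ≡ N * f 0
    on-diagonal f = trans (sumFin-cong n (λ i → cong f (dist-refl i))) (sumFin-const n (f 0))

  cubic : ℚ → ℚ
  cubic M = M * (ℕtoℚ 2 * M - 1ℚ) * (ℕtoℚ 4 * M - 1ℚ) - ℕtoℚ 6 * N * M * (ℕtoℚ 2 * M - 1ℚ)

  -- Σ_{t<2m} (t² − 2Nt) = cubic m / 3.
  sumℕ-cellGreen : ∀ m → ℕtoℚ 3 * sumℕ m (λ d → ℕtoℚ 2 * cellGreen d) ≡ ℕtoℚ 2 * A * cubic (toℚ m)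
  sumℕ-cellGreen zero    = solve 2 (λ a N → lit 3 :* con 0ℚ := lit 2 :* a :* cubic̲ N (con 0ℚ)) refl A N
  sumℕ-cellGreen (suc m) = begin
    ℕtoℚ 3 * sumℕ (suc m) f                       ≡⟨ cong (ℕtoℚ 3 *_) (sumℕ-snoc m f) ⟩
    ℕtoℚ 3 * (sumℕ m f + f m)                     ≡⟨ ℚP.*-distribˡ-+ (ℕtoℚ 3) (sumℕ m f) (f m) ⟩
    ℕtoℚ 3 * sumℕ m f + ℕtoℚ 3 * f m              ≡⟨ cong (_+ ℕtoℚ 3 * f m) (sumℕ-cellGreen m) ⟩
    ℕtoℚ 2 * A * cubic (toℚ m) + ℕtoℚ 3 * f m     ≡⟨ solve 3 (λ a N M → lit 2 :* a :* cubic̲ N M :+ lit 3 :* (lit 2 :* cellGreen̲ a N M)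
                                                                     := lit 2 :* a :* cubic̲ N (con 1ℚ :+ M)) refl A N (toℚ m) ⟩
    ℕtoℚ 2 * A * cubic (toℚ (suc m))              ∎
    where
    open ≡-Reasoning
    f : ℕ → ℚ
    f d = ℕtoℚ 2 * cellGreen d

  Kf-green : Kf (greenRes green) ≡ (ℕtoℚ 4 * (N * N * N) - N) * (1/ ℕtoℚ 3) + ℕtoℚ 6 * (N * N) * (ℕtoℚ 4 * B * (1ℚ + u n))
  Kf-green = begin
    Kf (greenRes green)                                                ≡⟨ Kf-greenRes green T green-rows ⟩
    toℚ (length (RVertices n)) * (Σℚ (RVertices n) (λ a → green a a) - T)
      ≡⟨ cong₂ (λ l t → l * (t - T)) (trans (cong toℚ length-RVertices) (toℚ-* 4 n)) green-diagonal ⟩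
    toℚ 4 * N * (N * (φ 1ℚ 0 + (φ 1ℚ 0 + (χ 1ℚ 0 + χ 1ℚ 0))) - T)
      ≡⟨ ≡-modulo {w = - (ℕtoℚ 4 * N * (1/ ℕtoℚ 3))} {x = ℕtoℚ 3 * T} {y = ℕtoℚ 2 * A * cubic N}
           (≡-modulo {w = N * (1/ ℕtoℚ 3) * (ℕtoℚ 4 * (N * N) - 1ℚ)} {x = A * (ℕtoℚ 8 * N)} {y = 1ℚ}
             (solve 5 (λ a b N t un →
                 con (toℚ 4) :* N :* (N :* (φ̲ a N (con 0ℚ) (con 1ℚ) (E₀̲ b un) :+ (φ̲ a N (con 0ℚ) (con 1ℚ) (E₀̲ b un)
                   :+ (χ̲ a N (con 0ℚ) (con 1ℚ) (E₀̲ b un) :+ χ̲ a N (con 0ℚ) (con 1ℚ) (E₀̲ b un)))) :- t)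
                 := ((lit 4 :* (N :* N :* N) :- N) :* con (1/ ℕtoℚ 3) :+ lit 6 :* (N :* N) :* (lit 4 :* b :* (con 1ℚ :+ un))
                     :+ (:- (lit 4 :* N :* con (1/ ℕtoℚ 3))) :* (lit 3 :* t :- lit 2 :* a :* cubic̲ N N))
                     :+ (N :* con (1/ ℕtoℚ 3) :* (lit 4 :* (N :* N) :- con 1ℚ)) :* (a :* (lit 8 :* N) :- con 1ℚ))
               refl A B N T (u n))
             A-inverse)
           (sumℕ-cellGreen n) ⟩
    (ℕtoℚ 4 * (N * N * N) - N) * (1/ ℕtoℚ 3) + ℕtoℚ 6 * (N * N) * (ℕtoℚ 4 * B * (1ℚ + u n)) ∎
    where open ≡-Reasoning

-- Arithmetic in ℚ(√2)

α^√ : ∀ k → α ^√ k ≡ (u k , - (ℕtoℚ 2 * v k))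
α^√ zero    = refl
α^√ (suc k) = begin
  α ⊗ (α ^√ k)                                ≡⟨ cong (α ⊗_) (α^√ k) ⟩
  α ⊗ (u k , - (ℕtoℚ 2 * v k))                ≡⟨ cong₂ _,_
      (solve 2 (λ x y → lit 3 :* x :+ lit 2 :* (con (- ℕtoℚ 2) :* (:- (lit 2 :* y)))
                        := lit 3 :* x :+ lit 8 :* y) refl (u k) (v k))
      (solve 2 (λ x y → lit 3 :* (:- (lit 2 :* y)) :+ con (- ℕtoℚ 2) :* x
                        := :- (lit 2 :* (x :+ lit 3 :* y))) refl (u k) (v k)) ⟩
  (ℕtoℚ 3 * u k + ℕtoℚ 8 * v k , - (ℕtoℚ 2 * (u k + ℕtoℚ 3 * v k)))
                                              ≡⟨ cong₂ (λ a b → (a , - (ℕtoℚ 2 * b))) (u-suc k) (v-suc k) ⟨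
  (u (suc k) , - (ℕtoℚ 2 * v (suc k)))        ∎
  where open ≡-Reasoning

inv-nonZero : ∀ a b → ¬ a * a - ℕtoℚ 2 * (b * b) ≡ 0ℚ →
              Σ ℚ λ d → inv (a , b) ≡ (a * d , - (b * d)) × d * (a * a - ℕtoℚ 2 * (b * b)) ≡ 1ℚ
inv-nonZero a b norm≢0 with (a * a - ℕtoℚ 2 * (b * b)) ℚP.≟ 0ℚ
... | yes norm≡0 = ⊥-elim (norm≢0 norm≡0)
... | no  norm≢0′ = 1/ norm , refl , ℚP.*-inverseˡ norm
  where
  norm = a * a - ℕtoℚ 2 * (b * b)
  instance _ = ℚ.≢-nonZero norm≢0′

cayley : ∀ a b → a * a - ℕtoℚ 8 * (b * b) ≡ 1ℚ → ¬ a ≡ 1ℚ →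
         Σ ℚ λ ρ → (emb 1ℚ ⊕ (a , - (ℕtoℚ 2 * b))) ⊘ (emb 1ℚ ⊖ (a , - (ℕtoℚ 2 * b))) ≡ (0ℚ , ρ)
                   × ρ * (a - 1ℚ) ≡ ℕtoℚ 2 * b
cayley a b pell a≢1 = ρ , quotient , ρ-spec
  where
  a′ b′ norm : ℚ
  a′   = 1ℚ - a
  b′   = 0ℚ - - (ℕtoℚ 2 * b)
  norm = a′ * a′ - ℕtoℚ 2 * (b′ * b′)

  a′̲ b′̲ : ∀ {m} → Polynomial m → Polynomial m
  a′̲ a = con 1ℚ :- a
  b′̲ b = con 0ℚ :- :- (lit 2 :* b)
  pell̲ : ∀ {m} → Polynomial m → Polynomial m → Polynomial m
  pell̲ a b = (a :* a :- lit 8 :* (b :* b)) :- con 1ℚ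

  norm≡ : norm ≡ ℕtoℚ 2 - ℕtoℚ 2 * a
  norm≡ = ≡-modulo {w = 1ℚ} {x = a * a - ℕtoℚ 8 * (b * b)} {y = 1ℚ}
    (solve 2 (λ a b → a′̲ a :* a′̲ a :- lit 2 :* (b′̲ b :* b′̲ b) := (lit 2 :- lit 2 :* a) :+ con 1ℚ :* pell̲ a b) refl a b)
    pell

  norm≢0 : ¬ norm ≡ 0ℚ
  norm≢0 norm≡0 = a≢1 (begin
    a                                 ≡⟨ solve 1 (λ a → a := con 1ℚ :- con ½ :* (lit 2 :- lit 2 :* a)) refl a ⟩
    1ℚ - ½ * (ℕtoℚ 2 - ℕtoℚ 2 * a)    ≡⟨ cong (λ t → 1ℚ - ½ * t) (trans (sym norm≡) norm≡0) ⟩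
    1ℚ - ½ * 0ℚ                       ≡⟨⟩
    1ℚ                                ∎)
    where open ≡-Reasoning

  d-spec : Σ ℚ λ d → inv (a′ , b′) ≡ (a′ * d , - (b′ * d)) × d * norm ≡ 1ℚ
  d-spec = inv-nonZero a′ b′ norm≢0
  d : ℚ
  d = proj₁ d-spec

  ρ : ℚ
  ρ = (1ℚ + a) * - (b′ * d) + (0ℚ + - (ℕtoℚ 2 * b)) * (a′ * d)

  quotient : (emb 1ℚ ⊕ (a , - (ℕtoℚ 2 * b))) ⊘ (emb 1ℚ ⊖ (a , - (ℕtoℚ 2 * b))) ≡ (0ℚ , ρ)
  quotient = trans (cong ((1ℚ + a , 0ℚ + - (ℕtoℚ 2 * b)) ⊗_) (proj₁ (proj₂ d-spec))) (cong (_, ρ) real-part)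
    where
    real-part : (1ℚ + a) * (a′ * d) + ℕtoℚ 2 * ((0ℚ + - (ℕtoℚ 2 * b)) * - (b′ * d)) ≡ 0ℚ
    real-part = ≡-modulo {w = - d} {x = a * a - ℕtoℚ 8 * (b * b)} {y = 1ℚ}
      (solve 3 (λ a b d → (con 1ℚ :+ a) :* (a′̲ a :* d) :+ lit 2 :* ((con 0ℚ :+ :- (lit 2 :* b)) :* :- (b′̲ b :* d))
                          := con 0ℚ :+ (:- d) :* pell̲ a b) refl a b d)
      pell

  ρ-spec : ρ * (a - 1ℚ) ≡ ℕtoℚ 2 * b
  ρ-spec = ≡-modulo {w = ℕtoℚ 2 * b} {x = d * norm} {y = 1ℚ}
    (≡-modulo {w = - (ℕtoℚ 2 * b * d)} {x = a * a - ℕtoℚ 8 * (b * b)} {y = 1ℚ}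
      (solve 3 (λ a b d →
          ((con 1ℚ :+ a) :* :- (b′̲ b :* d) :+ (con 0ℚ :+ :- (lit 2 :* b)) :* (a′̲ a :* d)) :* (a :- con 1ℚ)
          := (lit 2 :* b :+ (lit 2 :* b) :* (d :* (a′̲ a :* a′̲ a :- lit 2 :* (b′̲ b :* b′̲ b)) :- con 1ℚ))
             :+ (:- (lit 2 :* b :* d)) :* pell̲ a b) refl a b d)
      pell)
    (proj₂ (proj₂ d-spec))

-- The Kirchhoff index of Rₙ

module Kirchhoff (k : ℕ) where

  private
    n : ℕ
    n = suc k

  open R n
  open Chain k
  open Green k

  private
    mul̲ : ∀ {m} → Polynomial m × Polynomial m → Polynomial m × Polynomial m → Polynomial m × Polynomial m
    mul̲ (a , b) (c , d) = (a :* c :+ lit 2 :* (b :* d) , a :* d :+ b :* c)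

  formula : ℚ → ℚ√2 → ℚ√2
  formula M q = emb ((ℕtoℚ 4 * (M * M * M) - M) * (1/ ℕtoℚ 3)) ⊕ (((emb (ℕtoℚ 3) ⊗ √2) ⊗ emb (M * M)) ⊗ q)

  formula-imaginary : ∀ M ρ → formula M (0ℚ , ρ) ≡ ((ℕtoℚ 4 * (M * M * M) - M) * (1/ ℕtoℚ 3) + ℕtoℚ 6 * (M * M) * ρ , 0ℚ)
  formula-imaginary M ρ = cong₂ (λ x y → ((ℕtoℚ 4 * (M * M * M) - M) * (1/ ℕtoℚ 3) + x , 0ℚ + y))
    (solve 2 (λ M ρ → proj₁ (scaled̲ M ρ) := lit 6 :* (M :* M) :* ρ) refl M ρ)
    (solve 2 (λ M ρ → proj₂ (scaled̲ M ρ) := con 0ℚ) refl M ρ)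
    where
    scaled̲ : ∀ {m} → Polynomial m → Polynomial m → Polynomial m × Polynomial m
    scaled̲ M ρ = mul̲ (mul̲ (mul̲ (lit 3 , con 0ℚ) (con 0ℚ , con 1ℚ)) (M :* M , con 0ℚ)) (con 0ℚ , ρ)

  quotient : Σ ℚ λ ρ → (emb 1ℚ ⊕ (u n , - (ℕtoℚ 2 * v n))) ⊘ (emb 1ℚ ⊖ (u n , - (ℕtoℚ 2 * v n))) ≡ (0ℚ , ρ)
                        × ρ * (u n - 1ℚ) ≡ ℕtoℚ 2 * v n
  quotient = cayley (u n) (v n) (pell n) (u-suc≢1 k)
  ρ : ℚ
  ρ = proj₁ quotient

  ρ-value : ρ ≡ ℕtoℚ 4 * B * (1ℚ + u n)
  ρ-value = *-cancelʳ ρ (ℕtoℚ 4 * B * (1ℚ + u n)) (u n - 1ℚ) u-1≢0 (trans (proj₂ (proj₂ quotient)) (sym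
    (≡-modulo {w = ℕtoℚ 2 * v n} {x = B * (ℕtoℚ 16 * v n)} {y = 1ℚ}
      (≡-modulo {w = ℕtoℚ 4 * B} {x = u n * u n - ℕtoℚ 8 * (v n * v n)} {y = 1ℚ}
        (solve 3 (λ b u v → lit 4 :* b :* (con 1ℚ :+ u) :* (u :- con 1ℚ)
                            := (lit 2 :* v :+ lit 2 :* v :* (b :* (lit 16 :* v) :- con 1ℚ))
                               :+ lit 4 :* b :* ((u :* u :- lit 8 :* (v :* v)) :- con 1ℚ)) refl B (u n) (v n))
        (pell n))
      B-inverse)))
    where
    u-1≢0 : ¬ u n - 1ℚ ≡ 0ℚ
    u-1≢0 eq = u-suc≢1 k (trans (solve 1 (λ x → x := (x :- con 1ℚ) :+ con 1ℚ) refl (u n)) (trans (cong (_+ 1ℚ) eq) (ℚP.+-identityˡ 1ℚ)))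

  Kf-formula : emb (Kf (greenRes green)) ≡ KfFormula n
  Kf-formula = sym (begin
    KfFormula n
      ≡⟨⟩
    formula (ℕtoℚ n) ((emb 1ℚ ⊕ (α ^√ n)) ⊘ (emb 1ℚ ⊖ (α ^√ n)))
      ≡⟨ cong₂ (λ M p → formula M ((emb 1ℚ ⊕ p) ⊘ (emb 1ℚ ⊖ p))) (ℕtoℚ≡toℚ n) (α^√ n) ⟩
    formula N ((emb 1ℚ ⊕ (u n , - (ℕtoℚ 2 * v n))) ⊘ (emb 1ℚ ⊖ (u n , - (ℕtoℚ 2 * v n))))
      ≡⟨ cong (formula N) (proj₁ (proj₂ quotient)) ⟩
    formula N (0ℚ , ρ)
      ≡⟨ formula-imaginary N ρ ⟩
    (cubic-part + ℕtoℚ 6 * (N * N) * ρ , 0ℚ)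
      ≡⟨ cong (λ t → (cubic-part + ℕtoℚ 6 * (N * N) * t , 0ℚ)) ρ-value ⟩
    (cubic-part + ℕtoℚ 6 * (N * N) * (ℕtoℚ 4 * B * (1ℚ + u n)) , 0ℚ)
      ≡⟨ cong emb Kf-green ⟨
    emb (Kf (greenRes green))
      ∎)
    where
    open ≡-Reasoning
    cubic-part : ℚ
    cubic-part = (ℕtoℚ 4 * (N * N * N) - N) * (1/ ℕtoℚ 3)

  Kf-unique : ∀ r → IsResistanceFn r → Kf r ≡ Kf (greenRes green)
  Kf-unique r r-res = Σℚ-cong (pairs (RVertices n))
    (λ p → IsEffRes-unique connected (r-res (proj₁ p) (proj₂ p)) (isResistanceFn (proj₁ p) (proj₂ p)))

theorem5p2 : (n : ℕ) → 2 ≤ n →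
    Σ (Vtx n → Vtx n → ℚ) (R.IsResistanceFn n)
    × ((r : Vtx n → Vtx n → ℚ) → R.IsResistanceFn n r → emb (R.Kf n r) ≡ KfFormula n)
theorem5p2 (suc k) _ = (greenRes green , isResistanceFn) , λ r r-res → trans (cong emb (Kf-unique r r-res)) Kf-formula
  where
  open Kirchhoff k
  open Chain k
  open Green k
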